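{- Let $m\ge 1$ be a fixed integer. For a composition $\sigma=(a_1,\dots,a_k)$ (a finite sequence of positive integers, $k\ge 0$), let $|\sigma|=a_1+\cdots+a_k$, let $k$ be its number of parts, and let $\mathrm{st}_m(\sigma)$ be the number of indices $i$ with $1\le i\le k-m+1$ such that $a_{i+r-1}\ge r$ for every $r=1,\dots,m$ (the number of occurrences of the staircase $1^+2^+\cdots m^+$ in $\sigma$). Define the formal power series $$F=\sum_{\sigma} x^{|\sigma|}y^{k}q^{\mathrm{st}_m(\sigma)},$$ the sum running over all compositions $\sigma$ of all nonnegative integers (including the empty composition, which contributes $1$). For $n\ge 0$ put $$N_n=\sum_{j=0}^{n-1}x^{nj-\binom{j}{2}}\left(\frac{y}{1-x}\right)^{j}\qquad(\text{so }N_0=0).$$ Then $$F=\frac{N_{m}-\frac{qx^{m}y}{1-x}N_{m-1}}{(1-q)x^{\binom{m+1}{2}}\left(\frac{y}{1-x}\right)^{m}+\frac{1-x-xy}{1-x}\left(N_{m}-\frac{qx^{m}y}{1-x}N_{m-1}\right)}.$$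
   Context: A staircase $1^+2^+\cdots m^+$ is a word of $m$ consecutive parts in which, for $1\le i\le m$, the $i$th part is at least $i$; occurrences are counted as windows of consecutive parts of the composition. Here $x$ tracks the sum of the composition, $y$ the number of parts and $q$ the number of staircase occurrences. -}

module Defs where

open import Data.Bool using (Bool; true; false; _∧_; if_then_else_)
open import Data.Nat using (ℕ; zero; suc; _+_; _∸_; _≤ᵇ_; _≡ᵇ_; _≟_)
  renaming (_*_ to _*ℕ_)
open import Data.Nat.Combinatorics using (_C_)
open import Data.List using (List; []; _∷_; map; concatMap; upTo; length; filter)
open import Data.Nat.ListAction using (sum)
open import Data.Integer using (ℤ; 0ℤ; 1ℤ) renaming (_+_ to _+ℤ_; _*_ to _*ℤ_; -_ to -ℤ_)
open import Relation.Nullary.Decidable using (_×-dec_)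

words : ℕ → List ℕ → List (List ℕ)
words zero    A = [] ∷ []
words (suc k) A = concatMap (λ a → map (a ∷_) (words k A)) A

-- All compositions of n with exactly k parts: the lists of length k with
-- entries in {1,…,n} whose sum is n (every part of such a composition is ≤ n).
compositions : ℕ → ℕ → List (List ℕ)
compositions n k = filter (λ σ → sum σ ≟ n) (words k (map suc (upTo n)))

stairFrom : ℕ → ℕ → List ℕ → Bool
stairFrom r zero    w       = true
stairFrom r (suc m) []      = false
stairFrom r (suc m) (a ∷ w) = (r ≤ᵇ a) ∧ stairFrom (suc r) m w

st : ℕ → List ℕ → ℕ
st m []       = 0
st m (a ∷ w)  = (if stairFrom 1 m (a ∷ w) then 1 else 0) + st m w

-- Formal power series in x, y, q with integer coefficients:
-- f a b c is the coefficient of x^a y^b q^c.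

Ser : Set
Ser = ℕ → ℕ → ℕ → ℤ

Σ< : ℕ → (ℕ → ℤ) → ℤ
Σ< zero    f = 0ℤ
Σ< (suc n) f = Σ< n f +ℤ f n

infixl 6 _⊕_ _⊖_
infixl 7 _⊛_

_⊕_ : Ser → Ser → Ser
(f ⊕ g) a b c = f a b c +ℤ g a b c

⊝_ : Ser → Ser
(⊝ f) a b c = -ℤ (f a b c)

_⊖_ : Ser → Ser → Ser
f ⊖ g = f ⊕ (⊝ g)

_⊛_ : Ser → Ser → Ser
(f ⊛ g) a b c =
  Σ< (suc a) λ i → Σ< (suc b) λ j → Σ< (suc c) λ l →
    f i j l *ℤ g (a ∸ i) (b ∸ j) (c ∸ l)

zeroS : Ser
zeroS a b c = 0ℤ

mono : ℕ → ℕ → ℕ → Ser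
mono i j l a b c = if (i ≡ᵇ a) ∧ (j ≡ᵇ b) ∧ (l ≡ᵇ c) then 1ℤ else 0ℤ

oneS xS yS qS : Ser
oneS = mono 0 0 0
xS   = mono 1 0 0
yS   = mono 0 1 0
qS   = mono 0 0 1

-- 1/(1-x) = Σ_n x^n
geomX : Ser
geomX a b c = if (b ≡ᵇ 0) ∧ (c ≡ᵇ 0) then 1ℤ else 0ℤ

powS : Ser → ℕ → Ser
powS f zero    = oneS
powS f (suc n) = f ⊛ powS f n

ΣS : ℕ → (ℕ → Ser) → Ser
ΣS zero    g = zeroS
ΣS (suc n) g = ΣS n g ⊕ g n

u : Ser
u = yS ⊛ geomX

F : ℕ → Ser
F m a b c = Data.Integer.+ length (filter (λ σ → st m σ ≟ c) (compositions a b))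

N : ℕ → Ser
N n = ΣS n λ j → mono (n *ℕ j ∸ (j C 2)) 0 0 ⊛ powS u j

Num : ℕ → Ser
Num m = N m ⊖ (qS ⊛ mono m 0 0 ⊛ u ⊛ N (m ∸ 1))

Den : ℕ → Ser
Den m = ((oneS ⊖ qS) ⊛ mono (suc m C 2) 0 0 ⊛ powS u m)
      ⊕ ((oneS ⊖ xS ⊖ (xS ⊛ yS)) ⊛ geomX ⊛ Num m)

module Submission where

-- Reading a composition letter by letter, the windows that can still become occurrences
-- of 1⁺2⁺⋯m⁺ are exactly those started 1, …, t letters ago for some t < m, so a finite
-- automaton with states 0, …, m − 1 counts the occurrences.  Splitting off the first
-- part, the generating functions H_t of the compositions read from state t satisfy a
-- linear system.  The consecutive differences H_{t+1} − H_t turn out to be (q − 1) H_{m−1}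
-- times the summands x^{mj − C(j,2)} (y/(1−x))^j of N_m, so every H_t is H_{m−1} times an
-- explicit series P_t, and substituting into the last equation gives H_{m−1} · Q = 1 for an
-- explicit Q.  Hence F = H_0 = P_0 / Q, and P_0 and Q are identified with the numerator and
-- the denominator of the theorem.

open import Algebra.Bundles using (CommutativeRing)

module PowerSeries {c ℓ} (R : CommutativeRing c ℓ) where

  open import Data.Bool using (Bool; true; false; if_then_else_)
  open import Data.Nat using (ℕ; zero; suc; _∸_; _<_; s≤s; _≤ᵇ_; _≡ᵇ_)
    renaming (_+_ to _+ℕ_)
  open import Data.Nat.Properties
    using (≤-refl; m≤n⇒m≤1+n; m+n∸m≡n; ∸-+-assoc; m∸[m∸n]≡n; m+[n∸m]≡n; +-suc; +-∸-assoc; n∸n≡0)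
    renaming (+-identityʳ to +-identityʳ-ℕ)
  open import Data.Product using (_,_)
  import Relation.Binary.PropositionalEquality as ≡
  open import Algebra.Properties.CommutativeSemigroup
    (CommutativeRing.+-commutativeSemigroup R) using (interchange)

  open CommutativeRing R hiding (zero)
  open import Relation.Binary.Reasoning.Setoid setoid

  Series : Set c
  Series = ℕ → Carrier

  infix 4 _≋_
  _≋_ : Series → Series → Set ℓ
  f ≋ g = ∀ n → f n ≈ g n

  Σ : ℕ → (ℕ → Carrier) → Carrier
  Σ zero    f = 0#
  Σ (suc n) f = Σ n f + f n

  Σ-cong-< : ∀ n {f g : ℕ → Carrier} → (∀ i → i < n → f i ≈ g i) → Σ n f ≈ Σ n g
  Σ-cong-< zero    f≈g = refl
  Σ-cong-< (suc n) f≈g = +-cong (Σ-cong-< n λ i i<n → f≈g i (m≤n⇒m≤1+n i<n)) (f≈g n ≤-refl)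

  Σ-cong : ∀ n {f g : ℕ → Carrier} → (∀ i → f i ≈ g i) → Σ n f ≈ Σ n g
  Σ-cong n f≈g = Σ-cong-< n λ i _ → f≈g i

  Σ-zero : ∀ n → Σ n (λ _ → 0#) ≈ 0#
  Σ-zero zero    = refl
  Σ-zero (suc n) = trans (+-identityʳ _) (Σ-zero n)

  Σ-distrib-+ : ∀ n (f g : ℕ → Carrier) → Σ n (λ i → f i + g i) ≈ Σ n f + Σ n g
  Σ-distrib-+ zero    f g = sym (+-identityʳ 0#)
  Σ-distrib-+ (suc n) f g = trans (+-congʳ (Σ-distrib-+ n f g)) (interchange _ _ _ _)

  *-distribˡ-Σ : ∀ n a (f : ℕ → Carrier) → a * Σ n f ≈ Σ n (λ i → a * f i)
  *-distribˡ-Σ zero    a f = zeroʳ a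
  *-distribˡ-Σ (suc n) a f = trans (distribˡ a _ _) (+-congʳ (*-distribˡ-Σ n a f))

  *-distribʳ-Σ : ∀ n a (f : ℕ → Carrier) → Σ n f * a ≈ Σ n (λ i → f i * a)
  *-distribʳ-Σ zero    a f = zeroˡ a
  *-distribʳ-Σ (suc n) a f = trans (distribʳ a _ _) (+-congʳ (*-distribʳ-Σ n a f))

  Σ-head : ∀ n (f : ℕ → Carrier) → Σ (suc n) f ≈ f 0 + Σ n (λ i → f (suc i))
  Σ-head zero    f = trans (+-identityˡ _) (sym (+-identityʳ _))
  Σ-head (suc n) f = trans (+-congʳ (Σ-head n f)) (+-assoc _ _ _)

  Σ-reverse : ∀ n (f : ℕ → Carrier) → Σ (suc n) f ≈ Σ (suc n) (λ i → f (n ∸ i))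
  Σ-reverse zero    f = refl
  Σ-reverse (suc n) f = begin
    Σ (suc n) f + f (suc n)                  ≈⟨ +-congʳ (Σ-reverse n f) ⟩
    Σ (suc n) (λ i → f (n ∸ i)) + f (suc n)  ≈⟨ +-comm _ _ ⟩
    f (suc n) + Σ (suc n) (λ i → f (n ∸ i))  ≈⟨ Σ-head (suc n) (λ i → f (suc n ∸ i)) ⟨
    Σ (suc (suc n)) (λ i → f (suc n ∸ i))    ∎

  Σ-triangle : ∀ n (G : ℕ → ℕ → Carrier) →
    Σ (suc n) (λ k → Σ (suc k) (λ i → G i k)) ≈ Σ (suc n) (λ i → Σ (suc (n ∸ i)) (λ j → G i (i +ℕ j)))
  Σ-triangle zero    G = refl
  Σ-triangle (suc n) G = begin
    Σ (suc n) (λ k → Σ (suc k) (λ i → G i k)) + (Σ (suc n) (λ i → G i (suc n)) + G (suc n) (suc n))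
      ≈⟨ +-congʳ (Σ-triangle n G) ⟩
    Rows n + (Σ (suc n) (λ i → G i (suc n)) + G (suc n) (suc n))
      ≈⟨ +-assoc _ _ _ ⟨
    (Rows n + Σ (suc n) (λ i → G i (suc n))) + G (suc n) (suc n)
      ≈⟨ +-congʳ (Σ-distrib-+ (suc n) _ _) ⟨
    Σ (suc n) (λ i → Row n i + G i (suc n)) + G (suc n) (suc n)
      ≈⟨ +-cong (Σ-cong-< (suc n) extend-row) last-row ⟩
    Rows (suc n) ∎
    where
    Row : ℕ → ℕ → Carrier
    Row n i = Σ (suc (n ∸ i)) (λ j → G i (i +ℕ j))
    Rows : ℕ → Carrier
    Rows n = Σ (suc n) (Row n)
    extend-row : ∀ i → i < suc n → Row n i + G i (suc n) ≈ Row (suc n) i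
    extend-row i (s≤s i≤n) = begin
      Row n i + G i (suc n)                       ≡⟨ ≡.cong (λ k → Row n i + G i k) i+[1+n∸i]≡1+n ⟨
      Σ (suc (suc (n ∸ i))) (λ j → G i (i +ℕ j))  ≡⟨ ≡.cong (λ k → Σ (suc k) (λ j → G i (i +ℕ j))) (+-∸-assoc 1 i≤n) ⟨
      Row (suc n) i                               ∎
      where
      i+[1+n∸i]≡1+n : i +ℕ suc (n ∸ i) ≡.≡ suc n
      i+[1+n∸i]≡1+n = ≡.trans (+-suc i (n ∸ i)) (≡.cong suc (m+[n∸m]≡n i≤n))
    last-row : G (suc n) (suc n) ≈ Row (suc n) (suc n)
    last-row = begin
      G (suc n) (suc n)                   ≡⟨ ≡.cong (G (suc n)) (+-identityʳ-ℕ (suc n)) ⟨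
      G (suc n) (suc n +ℕ 0)              ≈⟨ +-identityˡ _ ⟨
      Σ 1 (λ j → G (suc n) (suc n +ℕ j))  ≡⟨ ≡.cong (λ k → Σ (suc k) (λ j → G (suc n) (suc n +ℕ j))) (n∸n≡0 n) ⟨
      Row (suc n) (suc n)                 ∎

  infixl 6 _⊞_
  infixl 7 _⊠_

  _⊞_ : Series → Series → Series
  (f ⊞ g) n = f n + g n

  ⊟_ : Series → Series
  (⊟ f) n = - f n

  𝟘 : Series
  𝟘 _ = 0#

  𝟙 : Series
  𝟙 zero    = 1#
  𝟙 (suc _) = 0#

  _⊠_ : Series → Series → Series
  (f ⊠ g) n = Σ (suc n) (λ i → f i * g (n ∸ i))

  ⊠-cong : ∀ {f f′ g g′} → f ≋ f′ → g ≋ g′ → f ⊠ g ≋ f′ ⊠ g′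
  ⊠-cong f≋f′ g≋g′ n = Σ-cong (suc n) λ i → *-cong (f≋f′ i) (g≋g′ (n ∸ i))

  ⊠-comm : ∀ f g → f ⊠ g ≋ g ⊠ f
  ⊠-comm f g n = begin
    Σ (suc n) (λ i → f i * g (n ∸ i))              ≈⟨ Σ-reverse n _ ⟩
    Σ (suc n) (λ i → f (n ∸ i) * g (n ∸ (n ∸ i)))  ≈⟨ Σ-cong-< (suc n) (λ { i (s≤s i≤n) →
                                                        *-congˡ (reflexive (≡.cong g (m∸[m∸n]≡n i≤n))) }) ⟩
    Σ (suc n) (λ i → f (n ∸ i) * g i)              ≈⟨ Σ-cong (suc n) (λ i → *-comm _ _) ⟩
    Σ (suc n) (λ i → g i * f (n ∸ i))              ∎

  ⊠-assoc : ∀ f g h → (f ⊠ g) ⊠ h ≋ f ⊠ (g ⊠ h)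
  ⊠-assoc f g h n = begin
    Σ (suc n) (λ k → Σ (suc k) (λ i → f i * g (k ∸ i)) * h (n ∸ k))
      ≈⟨ Σ-cong (suc n) (λ k → *-distribʳ-Σ (suc k) _ _) ⟩
    Σ (suc n) (λ k → Σ (suc k) (λ i → f i * g (k ∸ i) * h (n ∸ k)))
      ≈⟨ Σ-triangle n (λ i k → f i * g (k ∸ i) * h (n ∸ k)) ⟩
    Σ (suc n) (λ i → Σ (suc (n ∸ i)) (λ j → f i * g ((i +ℕ j) ∸ i) * h (n ∸ (i +ℕ j))))
      ≈⟨ Σ-cong (suc n) (λ i → Σ-cong (suc (n ∸ i)) (λ j → trans (*-assoc _ _ _)
           (*-congˡ (*-cong (reflexive (≡.cong g (m+n∸m≡n i j)))
                            (reflexive (≡.cong h (≡.sym (∸-+-assoc n i j)))))))) ⟩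
    Σ (suc n) (λ i → Σ (suc (n ∸ i)) (λ j → f i * (g j * h ((n ∸ i) ∸ j))))
      ≈⟨ Σ-cong (suc n) (λ i → *-distribˡ-Σ (suc (n ∸ i)) _ _) ⟨
    Σ (suc n) (λ i → f i * Σ (suc (n ∸ i)) (λ j → g j * h ((n ∸ i) ∸ j))) ∎

  ⊠-identityˡ : ∀ f → 𝟙 ⊠ f ≋ f
  ⊠-identityˡ f n = begin
    Σ (suc n) (λ i → 𝟙 i * f (n ∸ i))         ≈⟨ Σ-head n _ ⟩
    1# * f n + Σ n (λ i → 0# * f (n ∸ suc i))  ≈⟨ +-cong (*-identityˡ _) (Σ-cong n (λ i → zeroˡ _)) ⟩
    f n + Σ n (λ _ → 0#)                       ≈⟨ +-congˡ (Σ-zero n) ⟩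
    f n + 0#                                   ≈⟨ +-identityʳ _ ⟩
    f n                                        ∎

  ⊠-distribˡ : ∀ f g h → f ⊠ (g ⊞ h) ≋ f ⊠ g ⊞ f ⊠ h
  ⊠-distribˡ f g h n = trans (Σ-cong (suc n) (λ i → distribˡ _ _ _)) (Σ-distrib-+ (suc n) _ _)

  seriesRing : CommutativeRing c ℓ
  seriesRing = record
    { Carrier = Series
    ; _≈_ = _≋_
    ; _+_ = _⊞_
    ; _*_ = _⊠_
    ; -_ = ⊟_
    ; 0# = 𝟘
    ; 1# = 𝟙
    ; isCommutativeRing = record
      { isRing = record
        { +-isAbelianGroup = record
          { isGroup = record
            { isMonoid = record
              { isSemigroup = record
                { isMagma = record
                  { isEquivalence = record
                    { refl = λ n → refl ; sym = λ p n → sym (p n) ; trans = λ p q n → trans (p n) (q n) }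
                  ; ∙-cong = λ p q n → +-cong (p n) (q n) }
                ; assoc = λ f g h n → +-assoc _ _ _ }
              ; identity = (λ f n → +-identityˡ _) , (λ f n → +-identityʳ _) }
            ; inverse = (λ f n → -‿inverseˡ _) , (λ f n → -‿inverseʳ _)
            ; ⁻¹-cong = λ p n → -‿cong (p n) }
          ; comm = λ f g n → +-comm _ _ }
        ; *-cong = ⊠-cong
        ; *-assoc = ⊠-assoc
        ; *-identity = ⊠-identityˡ , λ f n → trans (⊠-comm f 𝟙 n) (⊠-identityˡ f n)
        ; distrib = ⊠-distribˡ , λ f g h n →
            trans (⊠-comm (g ⊞ h) f n) (trans (⊠-distribˡ f g h n) (+-cong (⊠-comm f g n) (⊠-comm f h n))) }
      ; *-comm = ⊠-comm }
    }

  monomial : ℕ → Carrier → Series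
  monomial k v n = if k ≡ᵇ n then v else 0#

  monomial-⊠ : ∀ k v f n → (monomial k v ⊠ f) n ≈ (if k ≤ᵇ n then v * f (n ∸ k) else 0#)
  monomial-⊠ k v f n = begin
    Σ (suc n) (λ i → (if k ≡ᵇ i then v else 0#) * f (n ∸ i))  ≈⟨ Σ-cong (suc n) (λ i → if-* (k ≡ᵇ i)) ⟩
    Σ (suc n) (λ i → if k ≡ᵇ i then v * f (n ∸ i) else 0#)    ≈⟨ Σ-single n k (λ i → v * f (n ∸ i)) ⟩
    (if k ≤ᵇ n then v * f (n ∸ k) else 0#)                    ∎
    where
    if-* : ∀ b {z} → (if b then v else 0#) * z ≈ (if b then v * z else 0#)
    if-* true  = refl
    if-* false = zeroˡ _
    Σ-single : ∀ n k (w : ℕ → Carrier) →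
      Σ (suc n) (λ i → if k ≡ᵇ i then w i else 0#) ≈ (if k ≤ᵇ n then w k else 0#)
    Σ-single n zero w = begin
      Σ (suc n) (λ i → if zero ≡ᵇ i then w i else 0#)  ≈⟨ Σ-head n _ ⟩
      w 0 + Σ n (λ _ → 0#)                             ≈⟨ +-congˡ (Σ-zero n) ⟩
      w 0 + 0#                                         ≈⟨ +-identityʳ _ ⟩
      w 0                                              ∎
    Σ-single zero    (suc k) w = +-identityˡ _
    Σ-single (suc n) (suc k) w = begin
      Σ (suc (suc n)) (λ i → if suc k ≡ᵇ i then w i else 0#)  ≈⟨ Σ-head (suc n) _ ⟩
      0# + Σ (suc n) (λ i → if k ≡ᵇ i then w (suc i) else 0#) ≈⟨ +-identityˡ _ ⟩
      Σ (suc n) (λ i → if k ≡ᵇ i then w (suc i) else 0#)      ≈⟨ Σ-single n k (λ i → w (suc i)) ⟩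
      (if k ≤ᵇ n then w (suc k) else 0#)                      ≡⟨ ≡.cong (λ b → if b then w (suc k) else 0#) (≤ᵇ-suc k n) ⟨
      (if suc k ≤ᵇ suc n then w (suc k) else 0#)              ∎
      where
      ≤ᵇ-suc : ∀ a b → (suc a ≤ᵇ suc b) ≡.≡ (a ≤ᵇ b)
      ≤ᵇ-suc zero    b = ≡.refl
      ≤ᵇ-suc (suc a) b = ≡.refl


module SeriesRing where

  open import Defs
  open import Data.Nat using (ℕ; zero; suc)
  open import Data.Integer using (ℤ; 0ℤ) renaming (_+_ to _+ℤ_)
  import Data.Integer.Properties as ℤ
  open import Data.Product using (_,_)
  open import Algebra.Bundles using (CommutativeRing)
  open import Relation.Binary.PropositionalEquality using (_≡_; refl; sym; trans; cong; cong₂)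

  -- Ser is ℤ[[q]][[y]][[x]]: the operations of Defs are those of three nested power series rings.
  module Z = PowerSeries ℤ.+-*-commutativeRing
  module ZQ = PowerSeries Z.seriesRing
  module ZYQ = PowerSeries ZQ.seriesRing
  module ZXYQ = CommutativeRing ZYQ.seriesRing

  Σ<-cong : ∀ n {f g : ℕ → ℤ} → (∀ i → f i ≡ g i) → Σ< n f ≡ Σ< n g
  Σ<-cong zero    f≡g = refl
  Σ<-cong (suc n) f≡g = cong₂ _+ℤ_ (Σ<-cong n f≡g) (f≡g n)

  Σ<-head : ∀ n (f : ℕ → ℤ) → Σ< (suc n) f ≡ f 0 +ℤ Σ< n (λ i → f (suc i))
  Σ<-head zero    f = ℤ.+-comm 0ℤ (f 0)
  Σ<-head (suc n) f = trans (cong (_+ℤ f (suc n)) (Σ<-head n f)) (ℤ.+-assoc (f 0) _ _)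

  Σ-q≡Σ< : ∀ n f → Z.Σ n f ≡ Σ< n f
  Σ-q≡Σ< zero    f = refl
  Σ-q≡Σ< (suc n) f = cong (_+ℤ f n) (Σ-q≡Σ< n f)

  Σ-yq≡Σ< : ∀ n h c → ZQ.Σ n h c ≡ Σ< n (λ i → h i c)
  Σ-yq≡Σ< zero    h c = refl
  Σ-yq≡Σ< (suc n) h c = cong (_+ℤ h n c) (Σ-yq≡Σ< n h c)

  Σ-xyq≡Σ< : ∀ n h b c → ZYQ.Σ n h b c ≡ Σ< n (λ i → h i b c)
  Σ-xyq≡Σ< zero    h b c = refl
  Σ-xyq≡Σ< (suc n) h b c = cong (_+ℤ h n b c) (Σ-xyq≡Σ< n h b c)

  ⊛-as-⊠ : ∀ f g → (f ⊛ g) ZXYQ.≈ (f ZYQ.⊠ g)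
  ⊛-as-⊠ f g a b c = sym (trans (Σ-xyq≡Σ< (suc a) _ b c) (Σ<-cong (suc a) λ i →
    trans (Σ-yq≡Σ< (suc b) _ c) (Σ<-cong (suc b) λ j → Σ-q≡Σ< (suc c) _)))

  oneS-as-𝟙 : oneS ZXYQ.≈ ZYQ.𝟙
  oneS-as-𝟙 zero    zero    zero    = refl
  oneS-as-𝟙 zero    zero    (suc c) = refl
  oneS-as-𝟙 zero    (suc b) c       = refl
  oneS-as-𝟙 (suc a) b       c       = refl

  -- Coefficientwise equality, wrapped in a record so that the compared series can be
  -- inferred from a proof.
  infix 4 _≈S_
  record _≈S_ (f g : Ser) : Set where
    constructor coeffs
    field coeff : ∀ a b c → f a b c ≡ g a b c
  open _≈S_ public

  private
    via-⊠ : ∀ f g f′ g′ → (f ZYQ.⊠ g) ZXYQ.≈ (f′ ZYQ.⊠ g′) → f ⊛ g ≈S f′ ⊛ g′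
    via-⊠ f g f′ g′ p = coeffs (ZXYQ.trans (⊛-as-⊠ f g) (ZXYQ.trans p (ZXYQ.sym (⊛-as-⊠ f′ g′))))

  ⊛-assoc : ∀ f g h → (f ⊛ g) ⊛ h ≈S f ⊛ (g ⊛ h)
  ⊛-assoc f g h = via-⊠ (f ⊛ g) h f (g ⊛ h) (ZXYQ.trans (ZYQ.⊠-cong {f ⊛ g} {f ZYQ.⊠ g} {h} (⊛-as-⊠ f g) ZXYQ.refl)
    (ZXYQ.trans (ZXYQ.*-assoc f g h) (ZYQ.⊠-cong {f} {f} {g ZYQ.⊠ h} {g ⊛ h} ZXYQ.refl (ZXYQ.sym (⊛-as-⊠ g h)))))

  ⊛-identityˡ : ∀ f → oneS ⊛ f ≈S f
  ⊛-identityˡ f = coeffs (ZXYQ.trans (⊛-as-⊠ oneS f)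
    (ZXYQ.trans (ZYQ.⊠-cong {oneS} {ZYQ.𝟙} {f} oneS-as-𝟙 ZXYQ.refl) (ZXYQ.*-identityˡ f)))

  ⊛-identityʳ : ∀ f → f ⊛ oneS ≈S f
  ⊛-identityʳ f = coeffs (ZXYQ.trans (⊛-as-⊠ f oneS)
    (ZXYQ.trans (ZYQ.⊠-cong {f} {f} {oneS} {ZYQ.𝟙} ZXYQ.refl oneS-as-𝟙) (ZXYQ.*-identityʳ f)))

  ⊛-distribˡ : ∀ f g h → f ⊛ (g ⊕ h) ≈S f ⊛ g ⊕ f ⊛ h
  ⊛-distribˡ f g h = coeffs (ZXYQ.trans (⊛-as-⊠ f (g ⊕ h))
    (ZXYQ.trans (ZXYQ.distribˡ f g h) (ZXYQ.+-cong (ZXYQ.sym (⊛-as-⊠ f g)) (ZXYQ.sym (⊛-as-⊠ f h)))))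

  ⊛-distribʳ : ∀ f g h → (g ⊕ h) ⊛ f ≈S g ⊛ f ⊕ h ⊛ f
  ⊛-distribʳ f g h = coeffs (ZXYQ.trans (⊛-as-⊠ (g ⊕ h) f)
    (ZXYQ.trans (ZXYQ.distribʳ f g h) (ZXYQ.+-cong (ZXYQ.sym (⊛-as-⊠ g f)) (ZXYQ.sym (⊛-as-⊠ h f)))))

  serRing : CommutativeRing _ _
  serRing = record
    { Carrier = Ser
    ; _≈_ = _≈S_
    ; _+_ = _⊕_
    ; _*_ = _⊛_
    ; -_ = ⊝_
    ; 0# = zeroS
    ; 1# = oneS
    ; isCommutativeRing = record
      { isRing = record
        { +-isAbelianGroup = record
          { isGroup = record
            { isMonoid = record
              { isSemigroup = record
                { isMagma = record
                  { isEquivalence = record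
                    { refl = coeffs ZXYQ.refl
                    ; sym = λ (coeffs p) → coeffs (ZXYQ.sym p)
                    ; trans = λ (coeffs p) (coeffs q) → coeffs (ZXYQ.trans p q) }
                  ; ∙-cong = λ (coeffs p) (coeffs q) → coeffs (ZXYQ.+-cong p q) }
                ; assoc = λ f g h → coeffs (ZXYQ.+-assoc f g h) }
              ; identity = (λ f → coeffs (ZXYQ.+-identityˡ f)) , (λ f → coeffs (ZXYQ.+-identityʳ f)) }
            ; inverse = (λ f → coeffs (ZXYQ.-‿inverseˡ f)) , (λ f → coeffs (ZXYQ.-‿inverseʳ f))
            ; ⁻¹-cong = λ (coeffs p) → coeffs (ZXYQ.-‿cong p) }
          ; comm = λ f g → coeffs (ZXYQ.+-comm f g) }
        ; *-cong = λ {f} {f′} {g} {g′} (coeffs p) (coeffs q) → via-⊠ f g f′ g′ (ZXYQ.*-cong p q)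
        ; *-assoc = ⊛-assoc
        ; *-identity = ⊛-identityˡ , ⊛-identityʳ
        ; distrib = ⊛-distribˡ , ⊛-distribʳ }
      ; *-comm = λ f g → via-⊠ f g g f (ZXYQ.*-comm f g) }
    }


module Coefficients where

  open import Defs
  open SeriesRing
  open import Data.Bool using (Bool; true; false; _∧_; if_then_else_)
  open import Data.Nat using (ℕ; zero; suc; _∸_; _≤ᵇ_; _≡ᵇ_)
  open import Data.Integer using (ℤ; 0ℤ; 1ℤ) renaming (_*_ to _*ℤ_)
  import Data.Integer.Properties as ℤ
  open import Relation.Binary.PropositionalEquality using (_≡_; refl; trans; cong)

  when : Bool → ℤ → ℤ
  when b z = if b then z else 0ℤ

  scaledMono : ℤ → ℕ → ℕ → ℕ → Ser
  scaledMono z i j l a b c = when ((i ≡ᵇ a) ∧ (j ≡ᵇ b) ∧ (l ≡ᵇ c)) z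

  scaledMono-⊛ : ∀ z i j l f a b c → (scaledMono z i j l ⊛ f) a b c ≡
    when (i ≤ᵇ a) (when (j ≤ᵇ b) (when (l ≤ᵇ c) (z *ℤ f (a ∸ i) (b ∸ j) (c ∸ l))))
  scaledMono-⊛ z i j l f a b c = trans (⊛-as-⊠ (scaledMono z i j l) f a b c)
    (trans (ZYQ.⊠-cong {scaledMono z i j l} {nested} {f} nested-form ZXYQ.refl a b c)
           (trans (ZYQ.monomial-⊠ i _ f a b c) (shift-yq (i ≤ᵇ a))))
    where
    nested : Ser
    nested = ZYQ.monomial i (ZQ.monomial j (Z.monomial l z))
    nested-form : scaledMono z i j l ZXYQ.≈ nested
    nested-form a b c with i ≡ᵇ a
    ... | false = refl
    ... | true with j ≡ᵇ b
    ...   | false = refl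
    ...   | true with l ≡ᵇ c
    ...     | false = refl
    ...     | true  = refl
    shift-yq : ∀ bb → (if bb then ZQ.monomial j (Z.monomial l z) ZQ.⊠ f (a ∸ i) else ZQ.𝟘) b c ≡
              when bb (when (j ≤ᵇ b) (when (l ≤ᵇ c) (z *ℤ f (a ∸ i) (b ∸ j) (c ∸ l))))
    shift-yq false = refl
    shift-yq true  = trans (ZQ.monomial-⊠ j _ (f (a ∸ i)) b c) (shift-q (j ≤ᵇ b))
      where
      shift-q : ∀ bb → (if bb then Z.monomial l z Z.⊠ f (a ∸ i) (b ∸ j) else Z.𝟘) c ≡
                when bb (when (l ≤ᵇ c) (z *ℤ f (a ∸ i) (b ∸ j) (c ∸ l)))
      shift-q false = refl
      shift-q true  = Z.monomial-⊠ l z (f (a ∸ i) (b ∸ j)) c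

  mono-⊛ : ∀ i j l f a b c → (mono i j l ⊛ f) a b c ≡
    when (i ≤ᵇ a) (when (j ≤ᵇ b) (when (l ≤ᵇ c) (f (a ∸ i) (b ∸ j) (c ∸ l))))
  mono-⊛ i j l f a b c = trans (scaledMono-⊛ 1ℤ i j l f a b c)
    (cong (when (i ≤ᵇ a)) (cong (when (j ≤ᵇ b)) (cong (when (l ≤ᵇ c)) (ℤ.*-identityˡ _))))

  geomX-⊛ : ∀ f a b c → (geomX ⊛ f) a b c ≡ Σ< (suc a) (λ i → f (a ∸ i) b c)
  geomX-⊛ f a b c = trans (⊛-as-⊠ geomX f a b c)
    (trans (ZYQ.⊠-cong {geomX} {λ _ → ZQ.𝟙} {f} geomX-form ZXYQ.refl a b c)
    (trans (Σ-xyq≡Σ< (suc a) _ b c) (Σ<-cong (suc a) (λ i → ZQ.⊠-identityˡ (f (a ∸ i)) b c))))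
    where
    geomX-form : geomX ZXYQ.≈ (λ _ → ZQ.𝟙)
    geomX-form a zero    zero    = refl
    geomX-form a zero    (suc c) = refl
    geomX-form a (suc b) c       = refl


module SeriesSolver where

  open import Defs
  open SeriesRing using (serRing; _≈S_; coeffs)
  open Coefficients using (when; scaledMono; scaledMono-⊛)
  open import Data.Bool using (Bool; true; false; _∧_)
  open import Data.Nat using (ℕ; _≡ᵇ_)
  open import Data.Maybe using (Maybe; just; nothing)
  open import Data.Product using (_×_; _,_)
  open import Data.Vec using (Vec; lookup)
  open import Data.Integer using (ℤ; 0ℤ) renaming (_+_ to _+ℤ_; _*_ to _*ℤ_; -_ to -ℤ_)
  import Data.Integer.Properties as ℤ
  open import Relation.Binary.PropositionalEquality using (_≡_; refl; sym; trans)
  open import Relation.Nullary using (yes; no)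
  open import Algebra.Bundles using (CommutativeRing)
  open import Algebra.Structures using (IsCommutativeRing)
  open import Algebra.Solver.Ring.AlmostCommutativeRing
    using (AlmostCommutativeRing; fromCommutativeRing; _-Raw-AlmostCommutative⟶_)
  import Algebra.Solver.Ring

  open CommutativeRing serRing using (setoid; +-cong; *-cong; -‿cong)
    renaming (refl to ≈-refl; sym to ≈-sym; trans to ≈-trans)

  -- The solver normalises with abstract copies of the operations, so that comparing two
  -- normal forms never unfolds a convolution; polynomials are still read back with the
  -- concrete operations, so solved equations match goals as written.
  infixl 6 _⊕ᵃ_
  infixl 7 _⊛ᵃ_
  abstract
    _⊕ᵃ_ _⊛ᵃ_ : Ser → Ser → Ser
    _⊕ᵃ_ = _⊕_
    _⊛ᵃ_ = _⊛_

    ⊝ᵃ_ : Ser → Ser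
    ⊝ᵃ_ = ⊝_

    zeroᵃ oneᵃ : Ser
    zeroᵃ = zeroS
    oneᵃ  = oneS

    ⊕ᵃ≈⊕ : ∀ f g → f ⊕ᵃ g ≈S f ⊕ g
    ⊕ᵃ≈⊕ f g = ≈-refl

    ⊛ᵃ≈⊛ : ∀ f g → f ⊛ᵃ g ≈S f ⊛ g
    ⊛ᵃ≈⊛ f g = ≈-refl

    ⊝ᵃ≈⊝ : ∀ f → ⊝ᵃ f ≈S ⊝ f
    ⊝ᵃ≈⊝ f = ≈-refl

    zeroᵃ≈zeroS : zeroᵃ ≈S zeroS
    zeroᵃ≈zeroS = ≈-refl

    oneᵃ≈oneS : oneᵃ ≈S oneS
    oneᵃ≈oneS = ≈-refl

    isCommutativeRingᵃ : IsCommutativeRing _≈S_ _⊕ᵃ_ _⊛ᵃ_ ⊝ᵃ_ zeroᵃ oneᵃ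
    isCommutativeRingᵃ = CommutativeRing.isCommutativeRing serRing

  serRingᵃ : CommutativeRing _ _
  serRingᵃ = record { isCommutativeRing = isCommutativeRingᵃ }

  -- constS 1ℤ is definitionally oneS, so the solver's con 1ℤ matches oneS in goals.
  constS : ℤ → Ser
  constS z = scaledMono z 0 0 0

  origin : ℕ → ℕ → ℕ → Bool
  origin a b c = (0 ≡ᵇ a) ∧ (0 ≡ᵇ b) ∧ (0 ≡ᵇ c)

  constS-homo : ∀ x y → constS (x *ℤ y) ≈S constS x ⊛ constS y
  constS-homo x y = coeffs λ a b c → trans (when-* (origin a b c)) (sym (scaledMono-⊛ x 0 0 0 (constS y) a b c))
    where
    when-* : ∀ bb → when bb (x *ℤ y) ≡ x *ℤ when bb y
    when-* true  = refl
    when-* false = sym (ℤ.*-zeroʳ x)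

  constS-morphism : CommutativeRing.rawRing ℤ.+-*-commutativeRing -Raw-AlmostCommutative⟶ fromCommutativeRing serRingᵃ
  constS-morphism = record
    { ⟦_⟧    = constS
    ; +-homo = λ x y → ≈-trans (coeffs λ a b c → when-+ (origin a b c)) (≈-sym (⊕ᵃ≈⊕ (constS x) (constS y)))
    ; *-homo = λ x y → ≈-trans (constS-homo x y) (≈-sym (⊛ᵃ≈⊛ (constS x) (constS y)))
    ; -‿homo = λ x → ≈-trans (coeffs λ a b c → when-neg (origin a b c)) (≈-sym (⊝ᵃ≈⊝ (constS x)))
    ; 0-homo = ≈-trans (coeffs λ a b c → when-0 (origin a b c)) (≈-sym zeroᵃ≈zeroS)
    ; 1-homo = ≈-sym oneᵃ≈oneS
    }
    where
    when-+ : ∀ {x y} bb → when bb (x +ℤ y) ≡ when bb x +ℤ when bb y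
    when-+ true  = refl
    when-+ false = refl
    when-neg : ∀ {x} bb → when bb (-ℤ x) ≡ -ℤ when bb x
    when-neg true  = refl
    when-neg false = refl
    when-0 : ∀ bb → when bb 0ℤ ≡ 0ℤ
    when-0 true  = refl
    when-0 false = refl

  constS-≟ : ∀ x y → Maybe (constS x ≈S constS y)
  constS-≟ x y with x ℤ.≟ y
  ... | yes refl = just ≈-refl
  ... | no _     = nothing

  module RingSolver = Algebra.Solver.Ring (CommutativeRing.rawRing ℤ.+-*-commutativeRing)
    (fromCommutativeRing serRingᵃ) constS-morphism constS-≟
  open RingSolver public using (Polynomial; _:+_; _:*_; _:-_; :-_; con)
  open RingSolver using (op; var; _:^_; Op)
  open import Algebra.Properties.Semiring.Exp
    (AlmostCommutativeRing.semiring (fromCommutativeRing serRingᵃ)) using (_^_; ^-congˡ)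

  ⟦_⟧ : ∀ {n} → Polynomial n → Vec Ser n → Ser
  ⟦ op Op.[+] p q ⟧ ρ = ⟦ p ⟧ ρ ⊕ ⟦ q ⟧ ρ
  ⟦ op Op.[*] p q ⟧ ρ = ⟦ p ⟧ ρ ⊛ ⟦ q ⟧ ρ
  ⟦ con c ⟧         ρ = constS c
  ⟦ var x ⟧         ρ = lookup ρ x
  ⟦ p :^ k ⟧        ρ = ⟦ p ⟧ ρ ^ k
  ⟦ :- p ⟧          ρ = ⊝ ⟦ p ⟧ ρ

  ⟦⟧-abstract : ∀ {n} (p : Polynomial n) ρ → ⟦ p ⟧ ρ ≈S RingSolver.⟦ p ⟧ ρ
  ⟦⟧-abstract (op Op.[+] p q) ρ = ≈-trans (+-cong (⟦⟧-abstract p ρ) (⟦⟧-abstract q ρ)) (≈-sym (⊕ᵃ≈⊕ _ _))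
  ⟦⟧-abstract (op Op.[*] p q) ρ = ≈-trans (*-cong (⟦⟧-abstract p ρ) (⟦⟧-abstract q ρ)) (≈-sym (⊛ᵃ≈⊛ _ _))
  ⟦⟧-abstract (con c)         ρ = ≈-refl
  ⟦⟧-abstract (var x)         ρ = ≈-refl
  ⟦⟧-abstract (p :^ k)        ρ = ^-congˡ k (⟦⟧-abstract p ρ)
  ⟦⟧-abstract (:- p)          ρ = ≈-trans (-‿cong (⟦⟧-abstract p ρ)) (≈-sym (⊝ᵃ≈⊝ _))

  normal-form-correct : ∀ {n} (p : Polynomial n) ρ → RingSolver.⟦ p ⟧↓ ρ ≈S ⟦ p ⟧ ρ
  normal-form-correct p ρ = ≈-trans (RingSolver.correct p ρ) (≈-sym (⟦⟧-abstract p ρ))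

  open import Relation.Binary.Reflection setoid var ⟦_⟧ RingSolver.⟦_⟧↓ normal-form-correct public
    using (solve)

  infix 4 _:=_
  _:=_ : ∀ {n} → Polynomial n → Polynomial n → Polynomial n × Polynomial n
  _:=_ = _,_


module Staircase where

  open import Defs using (stairFrom; st)
  open import Data.Bool using (Bool; true; false; _∧_; if_then_else_)
  open import Data.Bool.Properties using (∧-zeroʳ)
  open import Data.Empty using (⊥-elim)
  open import Data.List using (List; []; _∷_)
  open import Data.Nat using (ℕ; zero; suc; _+_; _∸_; _⊓_; _≤_; _<_; s≤s; _≤ᵇ_; _≡ᵇ_)
  open import Data.Nat.Properties
    using (≤-refl; ≤-trans; ≤-pred; m≤n⇒m≤1+n; <⇒≤; <⇒≱; ≰⇒>; ≤∧≢⇒<; <-irrefl; ≤ᵇ-reflects-≤; ≡ᵇ⇒≡; ≡⇒≡ᵇ;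
           +-comm; +-assoc; +-∸-assoc; +-identityʳ; n∸n≡0; m≤n⇒m⊓n≡m; m≥n⇒m⊓n≡n; +-commutativeSemigroup)
  open import Algebra.Properties.CommutativeSemigroup +-commutativeSemigroup using (x∙yz≈y∙xz; xy∙z≈y∙xz)
  open import Relation.Nullary.Reflects using (ofʸ; ofⁿ; fromEquivalence)
  open import Relation.Binary.PropositionalEquality using (_≡_; refl; sym; trans; cong; cong₂; module ≡-Reasoning)

  Σℕ : ℕ → (ℕ → ℕ) → ℕ
  Σℕ zero    f = 0
  Σℕ (suc n) f = Σℕ n f + f n

  Σℕ-cong-< : ∀ n {f g} → (∀ i → i < n → f i ≡ g i) → Σℕ n f ≡ Σℕ n g
  Σℕ-cong-< zero    f≡g = refl
  Σℕ-cong-< (suc n) f≡g = cong₂ _+_ (Σℕ-cong-< n λ i i<n → f≡g i (m≤n⇒m≤1+n i<n)) (f≡g n ≤-refl)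

  Σℕ-cong : ∀ n {f g} → (∀ i → f i ≡ g i) → Σℕ n f ≡ Σℕ n g
  Σℕ-cong n f≡g = Σℕ-cong-< n λ i _ → f≡g i

  Σℕ-zero : ∀ n {f} → (∀ i → i < n → f i ≡ 0) → Σℕ n f ≡ 0
  Σℕ-zero zero    f≡0 = refl
  Σℕ-zero (suc n) f≡0 = cong₂ _+_ (Σℕ-zero n λ i i<n → f≡0 i (m≤n⇒m≤1+n i<n)) (f≡0 n ≤-refl)

  Σℕ-head : ∀ n f → Σℕ (suc n) f ≡ f 0 + Σℕ n (λ i → f (suc i))
  Σℕ-head zero    f = +-comm 0 (f 0)
  Σℕ-head (suc n) f = trans (cong (_+ f (suc n)) (Σℕ-head n f)) (+-assoc (f 0) _ _)

  Σℕ-truncate : ∀ n a (f : ℕ → ℕ) → Σℕ n (λ i → if suc i ≤ᵇ a then f i else 0) ≡ Σℕ (n ⊓ a) f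
  Σℕ-truncate zero    a f = refl
  Σℕ-truncate (suc n) a f with suc n ≤ᵇ a | ≤ᵇ-reflects-≤ (suc n) a
  ... | true  | ofʸ n<a = begin
    Σℕ n _ + f n          ≡⟨ cong (_+ f n) (Σℕ-truncate n a f) ⟩
    Σℕ (n ⊓ a) f + f n    ≡⟨ cong (λ k → Σℕ k f + f n) (m≤n⇒m⊓n≡m (<⇒≤ n<a)) ⟩
    Σℕ (suc n) f          ≡⟨ cong (λ k → Σℕ k f) (m≤n⇒m⊓n≡m n<a) ⟨
    Σℕ (suc n ⊓ a) f      ∎
    where open ≡-Reasoning
  ... | false | ofⁿ n≮a = begin
    Σℕ n _ + 0            ≡⟨ +-identityʳ _ ⟩
    Σℕ n _                ≡⟨ Σℕ-truncate n a f ⟩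
    Σℕ (n ⊓ a) f          ≡⟨ cong (λ k → Σℕ k f) (m≥n⇒m⊓n≡n a≤n) ⟩
    Σℕ a f                ≡⟨ cong (λ k → Σℕ k f) (m≥n⇒m⊓n≡n (m≤n⇒m≤1+n a≤n)) ⟨
    Σℕ (suc n ⊓ a) f      ∎
    where
    open ≡-Reasoning
    a≤n : a ≤ n
    a≤n with ≰⇒> n≮a
    ... | s≤s a≤n = a≤n

  bit : Bool → ℕ
  bit b = if b then 1 else 0

  bit-∧ : ∀ b x → bit (b ∧ x) ≡ (if b then bit x else 0)
  bit-∧ true  x = refl
  bit-∧ false x = refl

  ≤ᵇ-true : ∀ {a b} → a ≤ b → (a ≤ᵇ b) ≡ true
  ≤ᵇ-true {a} {b} a≤b with a ≤ᵇ b | ≤ᵇ-reflects-≤ a b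
  ... | true  | _        = refl
  ... | false | ofⁿ a≰b = ⊥-elim (a≰b a≤b)

  ≤ᵇ-false : ∀ {a b} → b < a → (a ≤ᵇ b) ≡ false
  ≤ᵇ-false {a} {b} b<a with a ≤ᵇ b | ≤ᵇ-reflects-≤ a b
  ... | false | _        = refl
  ... | true  | ofʸ a≤b = ⊥-elim (<⇒≱ b<a a≤b)

  ≡ᵇ-refl : ∀ m → (m ≡ᵇ m) ≡ true
  ≡ᵇ-refl zero    = refl
  ≡ᵇ-refl (suc m) = ≡ᵇ-refl m

  ≡ᵇ-false : ∀ {t m} → t < m → (t ≡ᵇ m) ≡ false
  ≡ᵇ-false {t} {m} t<m with t ≡ᵇ m | fromEquivalence (≡ᵇ⇒≡ t m) (≡⇒≡ᵇ t m)
  ... | false | _        = refl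
  ... | true  | ofʸ t≡m = ⊥-elim (<-irrefl t≡m t<m)

  +-≡ᵇ : ∀ a x s → (a + x ≡ᵇ s) ≡ (a ≤ᵇ s) ∧ (x ≡ᵇ s ∸ a)
  +-≡ᵇ zero    x s       = refl
  +-≡ᵇ (suc a) x zero    = refl
  +-≡ᵇ (suc a) x (suc s) = trans (+-≡ᵇ a x s) (cong (_∧ (x ≡ᵇ s ∸ a)) (≤ᵇ-suc a s))
    where
    ≤ᵇ-suc : ∀ a b → (a ≤ᵇ b) ≡ (suc a ≤ᵇ suc b)
    ≤ᵇ-suc zero    b = refl
    ≤ᵇ-suc (suc a) b = refl

  -- An automaton counting occurrences of 1⁺2⁺⋯m⁺, m = suc m′.  Its state t ≤ m′ records
  -- that exactly the windows started 1, …, t letters ago can still complete (a window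
  -- started i letters ago needs its next letter ≥ i + 1, so the live ones form an initial
  -- segment); reading a completes the oldest window when t = m′ and a ≥ m.

  step : ℕ → ℕ → ℕ → ℕ
  step m′ t a = if a ≤ᵇ t then a else (if t ≡ᵇ m′ then m′ else suc t)

  completes : ℕ → ℕ → ℕ → Bool
  completes m′ t a = (t ≡ᵇ m′) ∧ (suc m′ ≤ᵇ a)

  occurrences : ℕ → ℕ → List ℕ → ℕ
  occurrences m′ t []      = 0
  occurrences m′ t (a ∷ w) = bit (completes m′ t a) + occurrences m′ (step m′ t a) w

  -- the first letters of w complete a window started k letters before w
  pending : ℕ → ℕ → List ℕ → Bool
  pending m′ k w = stairFrom (suc k) (suc m′ ∸ k) w

  pendingCount : ℕ → ℕ → List ℕ → ℕ
  pendingCount m′ t w = Σℕ t (λ i → bit (pending m′ (suc i) w))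

  step-≤ : ∀ m′ t a → t ≤ m′ → step m′ t a ≤ m′
  step-≤ m′ t a t≤m′ with a ≤ᵇ t | ≤ᵇ-reflects-≤ a t
  ... | true  | ofʸ a≤t = ≤-trans a≤t t≤m′
  ... | false | _ with t ≡ᵇ m′ | fromEquivalence (≡ᵇ⇒≡ t m′) (≡⇒≡ᵇ t m′)
  ...   | true  | _        = ≤-refl
  ...   | false | ofⁿ t≢m′ = ≤∧≢⇒< t≤m′ t≢m′

  completes-below : ∀ m′ t a → a ≤ t → t ≤ m′ → completes m′ t a ≡ false
  completes-below m′ t a a≤t t≤m′ = trans (cong ((t ≡ᵇ m′) ∧_) (≤ᵇ-false (s≤s (≤-trans a≤t t≤m′)))) (∧-zeroʳ _)

  pending-∷ : ∀ m′ k a w → k ≤ m′ → pending m′ k (a ∷ w) ≡ (suc k ≤ᵇ a) ∧ pending m′ (suc k) w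
  pending-∷ m′ k a w k≤m′ = cong (λ n → stairFrom (suc k) n (a ∷ w)) (+-∸-assoc 1 k≤m′)

  st-∷-pendingCount : ∀ m′ t a w → t ≤ m′ →
    st (suc m′) (a ∷ w) + pendingCount m′ t (a ∷ w) ≡ st (suc m′) w + pendingCount m′ (suc t ⊓ a) w
  st-∷-pendingCount m′ t a w t≤m′ = begin
    (P 0 (a ∷ w) + st (suc m′) w) + Σℕ t (λ i → P (suc i) (a ∷ w))
      ≡⟨ xy∙z≈y∙xz (P 0 (a ∷ w)) (st (suc m′) w) _ ⟩
    st (suc m′) w + (P 0 (a ∷ w) + Σℕ t (λ i → P (suc i) (a ∷ w)))
      ≡⟨ cong (st (suc m′) w +_) (Σℕ-head t (λ i → P i (a ∷ w))) ⟨
    st (suc m′) w + Σℕ (suc t) (λ i → P i (a ∷ w))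
      ≡⟨ cong (st (suc m′) w +_) (Σℕ-cong-< (suc t) λ i i<1+t → trans
           (cong bit (pending-∷ m′ i a w (≤-trans (≤-pred i<1+t) t≤m′))) (bit-∧ (suc i ≤ᵇ a) _)) ⟩
    st (suc m′) w + Σℕ (suc t) (λ i → if suc i ≤ᵇ a then P (suc i) w else 0)
      ≡⟨ cong (st (suc m′) w +_) (Σℕ-truncate (suc t) a (λ i → P (suc i) w)) ⟩
    st (suc m′) w + pendingCount m′ (suc t ⊓ a) w ∎
    where
    open ≡-Reasoning
    P : ℕ → List ℕ → ℕ
    P k w = bit (pending m′ k w)

  step-pendingCount : ∀ m′ t a w → t ≤ m′ →
    bit (completes m′ t a) + pendingCount m′ (step m′ t a) w ≡ pendingCount m′ (suc t ⊓ a) w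
  step-pendingCount m′ t a w t≤m′ with a ≤ᵇ t | ≤ᵇ-reflects-≤ a t
  ... | true | ofʸ a≤t = trans (cong (λ b → bit b + pendingCount m′ a w) (completes-below m′ t a a≤t t≤m′))
                               (cong (λ k → pendingCount m′ k w) (sym (m≥n⇒m⊓n≡n (m≤n⇒m≤1+n a≤t))))
  ... | false | ofⁿ a≰t with t ≡ᵇ m′ | fromEquivalence (≡ᵇ⇒≡ t m′) (≡⇒≡ᵇ t m′)
  ...   | false | _ = cong (λ k → pendingCount m′ k w) (sym (m≤n⇒m⊓n≡m (≰⇒> a≰t)))
  ...   | true  | ofʸ refl = begin
    bit (suc m′ ≤ᵇ a) + pendingCount m′ m′ w ≡⟨ cong (λ b → bit b + pendingCount m′ m′ w) (≤ᵇ-true (≰⇒> a≰t)) ⟩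
    1 + pendingCount m′ m′ w                 ≡⟨ +-comm 1 _ ⟩
    pendingCount m′ m′ w + 1                 ≡⟨ cong (λ n → pendingCount m′ m′ w + bit (stairFrom (suc (suc m′)) n w)) (n∸n≡0 m′) ⟨
    pendingCount m′ (suc m′) w               ≡⟨ cong (λ k → pendingCount m′ k w) (m≤n⇒m⊓n≡m (≰⇒> a≰t)) ⟨
    pendingCount m′ (suc m′ ⊓ a) w           ∎
    where open ≡-Reasoning

  occurrences-correct : ∀ m′ t w → t ≤ m′ → occurrences m′ t w ≡ st (suc m′) w + pendingCount m′ t w
  occurrences-correct m′ t []      t≤m′ = sym (Σℕ-zero t λ i i<t →
    cong (λ n → bit (stairFrom (suc (suc i)) n [])) (+-∸-assoc 1 (≤-trans i<t t≤m′)))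
  occurrences-correct m′ t (a ∷ w) t≤m′ = begin
    bit c + occurrences m′ (step m′ t a) w                       ≡⟨ cong (bit c +_) (occurrences-correct m′ (step m′ t a) w (step-≤ m′ t a t≤m′)) ⟩
    bit c + (st (suc m′) w + pendingCount m′ (step m′ t a) w)    ≡⟨ x∙yz≈y∙xz (bit c) (st (suc m′) w) _ ⟩
    st (suc m′) w + (bit c + pendingCount m′ (step m′ t a) w)    ≡⟨ cong (st (suc m′) w +_) (step-pendingCount m′ t a w t≤m′) ⟩
    st (suc m′) w + pendingCount m′ (suc t ⊓ a) w                ≡⟨ st-∷-pendingCount m′ t a w t≤m′ ⟨
    st (suc m′) (a ∷ w) + pendingCount m′ t (a ∷ w)              ∎
    where
    open ≡-Reasoning
    c = completes m′ t a


module Counting where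

  open import Defs
  open Staircase
  open import Data.Bool using (Bool; true; false; _∧_; if_then_else_)
  open import Data.Bool.Properties using (∧-zeroʳ)
  open import Data.List using (List; []; _∷_; map; concatMap; upTo; applyUpTo; length; filter; _++_)
  open import Data.Nat using (ℕ; zero; suc; _+_; _∸_; _≤_; z≤n; _≤ᵇ_; _≡ᵇ_; _≟_)
  open import Data.Nat.ListAction using (sum)
  import Data.Integer as ℤ
  open import Data.Nat.Properties using (≤-refl; ≤-trans; m∸n≤m; m≥n⇒m⊓n≡n; +-identityʳ; +-assoc)
  open import Relation.Nullary using (does)
  open import Relation.Unary using (Pred; Decidable)
  open import Relation.Binary.PropositionalEquality using (_≡_; refl; sym; trans; cong; cong₂; module ≡-Reasoning)

  count : (List ℕ → Bool) → List (List ℕ) → ℕ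
  count p []       = 0
  count p (w ∷ ws) = bit (p w) + count p ws

  length-filter-filter : ∀ {a} {P Q : Pred (List ℕ) a} (P? : Decidable P) (Q? : Decidable Q) ws →
    length (filter P? (filter Q? ws)) ≡ count (λ w → does (Q? w) ∧ does (P? w)) ws
  length-filter-filter P? Q? []       = refl
  length-filter-filter P? Q? (w ∷ ws) with does (Q? w)
  ... | false = length-filter-filter P? Q? ws
  ... | true with does (P? w)
  ...   | false = length-filter-filter P? Q? ws
  ...   | true  = cong suc (length-filter-filter P? Q? ws)

  count-cong : ∀ {p q} ws → (∀ w → p w ≡ q w) → count p ws ≡ count q ws
  count-cong []       p≡q = refl
  count-cong (w ∷ ws) p≡q = cong₂ _+_ (cong bit (p≡q w)) (count-cong ws p≡q)

  count-++ : ∀ p ws vs → count p (ws ++ vs) ≡ count p ws + count p vs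
  count-++ p []       vs = refl
  count-++ p (w ∷ ws) vs = trans (cong (bit (p w) +_) (count-++ p ws vs)) (sym (+-assoc (bit (p w)) _ _))

  count-map-∷ : ∀ p a ws → count p (map (a ∷_) ws) ≡ count (λ w → p (a ∷ w)) ws
  count-map-∷ p a []       = refl
  count-map-∷ p a (w ∷ ws) = cong (bit (p (a ∷ w)) +_) (count-map-∷ p a ws)

  count-false : ∀ ws → count (λ _ → false) ws ≡ 0
  count-false []       = refl
  count-false (w ∷ ws) = count-false ws

  count-concatMap : ∀ n h p (f : ℕ → List (List ℕ)) →
    count p (concatMap f (map suc (applyUpTo h n))) ≡ Σℕ n (λ i → count p (f (suc (h i))))
  count-concatMap zero    h p f = refl
  count-concatMap (suc n) h p f = trans (count-++ p (f (suc (h 0))) _)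
    (trans (cong (count p (f (suc (h 0))) +_) (count-concatMap n (λ i → h (suc i)) p f))
           (sym (Σℕ-head n (λ i → count p (f (suc (h i)))))))

  count-guard : ∀ A D (X Y : List ℕ → Bool) ws →
    count (λ w → (A ∧ X w) ∧ (D ∧ Y w)) ws ≡ (if A then (if D then count (λ w → X w ∧ Y w) ws else 0) else 0)
  count-guard false D     X Y ws = count-false ws
  count-guard true  false X Y ws = trans (count-cong ws λ w → ∧-zeroʳ (X w)) (count-false ws)
  count-guard true  true  X Y ws = refl

  -- compositionCount m′ t s k c counts the compositions of s into k parts on which the
  -- automaton started in state t completes c windows.

  compositionCount : ℕ → ℕ → ℕ → ℕ → ℕ → ℕ
  compositionCount m′ t s zero    c = bit ((0 ≡ᵇ s) ∧ (0 ≡ᵇ c))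
  compositionCount m′ t s (suc k) c = Σℕ s λ i → let d = bit (completes m′ t (suc i)) in
    if d ≤ᵇ c then compositionCount m′ (step m′ t (suc i)) (s ∸ suc i) k (c ∸ d) else 0

  matches : ℕ → ℕ → ℕ → ℕ → List ℕ → Bool
  matches m′ t s c w = (sum w ≡ᵇ s) ∧ (occurrences m′ t w ≡ᵇ c)

  count-matches-∷ : ∀ m′ t s c a ws → let d = bit (completes m′ t a) in
    count (λ w → matches m′ t s c (a ∷ w)) ws ≡
    (if a ≤ᵇ s then (if d ≤ᵇ c then count (matches m′ (step m′ t a) (s ∸ a) (c ∸ d)) ws else 0) else 0)
  count-matches-∷ m′ t s c a ws = trans
    (count-cong ws λ w → cong₂ _∧_ (+-≡ᵇ a (sum w) s) (+-≡ᵇ (bit (completes m′ t a)) (occurrences m′ (step m′ t a) w) c))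
    (count-guard (a ≤ᵇ s) (bit (completes m′ t a) ≤ᵇ c) _ _ ws)

  count-matches-words : ∀ m′ N t s k c → s ≤ N →
    count (matches m′ t s c) (words k (map suc (upTo N))) ≡ compositionCount m′ t s k c
  count-matches-words m′ N t s zero    c s≤N = +-identityʳ _
  count-matches-words m′ N t s (suc k) c s≤N = begin
    count (matches m′ t s c) (concatMap (λ a → map (a ∷_) (words k A)) A)
      ≡⟨ count-concatMap N (λ i → i) (matches m′ t s c) (λ a → map (a ∷_) (words k A)) ⟩
    Σℕ N (λ i → count (matches m′ t s c) (map (suc i ∷_) (words k A)))
      ≡⟨ Σℕ-cong N (λ i → trans (count-map-∷ _ (suc i) (words k A)) (count-matches-∷ m′ t s c (suc i) (words k A))) ⟩
    Σℕ N (λ i → if suc i ≤ᵇ s then count-rest i else 0)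
      ≡⟨ Σℕ-cong N (λ i → cong (λ z → if suc i ≤ᵇ s then z else 0) (count-rest≡ i)) ⟩
    Σℕ N (λ i → if suc i ≤ᵇ s then term i else 0)
      ≡⟨ Σℕ-truncate N s term ⟩
    Σℕ (Data.Nat._⊓_ N s) term
      ≡⟨ cong (λ n → Σℕ n term) (m≥n⇒m⊓n≡n s≤N) ⟩
    compositionCount m′ t s (suc k) c ∎
    where
    open ≡-Reasoning
    A = map suc (upTo N)
    d : ℕ → ℕ
    d i = bit (completes m′ t (suc i))
    count-rest term : ℕ → ℕ
    count-rest i = if d i ≤ᵇ c then count (matches m′ (step m′ t (suc i)) (s ∸ suc i) (c ∸ d i)) (words k A) else 0
    term i = if d i ≤ᵇ c then compositionCount m′ (step m′ t (suc i)) (s ∸ suc i) k (c ∸ d i) else 0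
    count-rest≡ : ∀ i → count-rest i ≡ term i
    count-rest≡ i = cong (λ z → if d i ≤ᵇ c then z else 0)
      (count-matches-words m′ N (step m′ t (suc i)) (s ∸ suc i) k (c ∸ d i) (≤-trans (m∸n≤m s (suc i)) s≤N))

  F-coefficient : ∀ m′ a b c → F (suc m′) a b c ≡ ℤ.+ compositionCount m′ 0 a b c
  F-coefficient m′ a b c = cong ℤ.+_ (begin
    length (filter (λ σ → st (suc m′) σ ≟ c) (filter (λ σ → sum σ ≟ a) candidates))
      ≡⟨ length-filter-filter (λ σ → st (suc m′) σ ≟ c) (λ σ → sum σ ≟ a) candidates ⟩
    count (λ σ → (sum σ ≡ᵇ a) ∧ (st (suc m′) σ ≡ᵇ c)) candidates
      ≡⟨ count-cong candidates (λ σ → cong (λ n → (sum σ ≡ᵇ a) ∧ (n ≡ᵇ c)) (st≡occurrences σ)) ⟩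
    count (matches m′ 0 a c) candidates
      ≡⟨ count-matches-words m′ a 0 a b c ≤-refl ⟩
    compositionCount m′ 0 a b c ∎)
    where
    open ≡-Reasoning
    candidates : List (List ℕ)
    candidates = words b (map suc (upTo a))
    st≡occurrences : ∀ σ → st (suc m′) σ ≡ occurrences m′ 0 σ
    st≡occurrences σ = sym (trans (occurrences-correct m′ 0 σ z≤n) (+-identityʳ _))


module SeriesFacts where

  open import Defs
  open SeriesRing using (serRing; _≈S_; coeffs)
  open Coefficients using (when; mono-⊛)
  open Staircase using (+-≡ᵇ)
  open SeriesSolver using (solve; _:=_; _:-_; _:*_)
  open import Data.Bool using (Bool; true; false; _∧_)
  open import Data.Nat using (ℕ; zero; suc; _+_; _∸_; _<_; _≤ᵇ_; _≡ᵇ_)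
  open import Data.Integer using (1ℤ) renaming (-_ to -ℤ_; _+_ to _+ℤ_)
  import Data.Integer.Properties as ℤ
  import Relation.Binary.PropositionalEquality as ≡
  open import Algebra.Bundles using (CommutativeRing)

  open CommutativeRing serRing
    using (setoid; refl; sym; trans; +-cong; +-congˡ; +-congʳ; *-congˡ; *-congʳ; *-identityˡ; -‿cong; -‿inverseʳ; zeroʳ; +-identityʳ)
  open import Relation.Binary.Reasoning.Setoid setoid

  module Sums = PowerSeries serRing using (Σ; Σ-cong-<; Σ-distrib-+; *-distribˡ-Σ; Σ-head)

  ⊕-congˡ : ∀ a {b c} → b ≈S c → a ⊕ b ≈S a ⊕ c
  ⊕-congˡ a = +-congˡ {a}

  ⊕-congʳ : ∀ c {a b} → a ≈S b → a ⊕ c ≈S b ⊕ c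
  ⊕-congʳ c = +-congʳ {c}

  ⊛-congˡ : ∀ a {b c} → b ≈S c → a ⊛ b ≈S a ⊛ c
  ⊛-congˡ a = *-congˡ {a}

  ⊛-congʳ : ∀ c {a b} → a ≈S b → a ⊛ c ≈S b ⊛ c
  ⊛-congʳ c = *-congʳ {c}

  ΣS≡Σ : ∀ n f → ΣS n f ≡.≡ Sums.Σ n f
  ΣS≡Σ zero    f = ≡.refl
  ΣS≡Σ (suc n) f = ≡.cong (_⊕ f n) (ΣS≡Σ n f)

  ΣS-cong-< : ∀ n {f g} → (∀ i → i < n → f i ≈S g i) → ΣS n f ≈S ΣS n g
  ΣS-cong-< n {f} {g} f≈g = begin
    ΣS n f      ≡⟨ ΣS≡Σ n f ⟩
    Sums.Σ n f  ≈⟨ Sums.Σ-cong-< n f≈g ⟩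
    Sums.Σ n g  ≡⟨ ΣS≡Σ n g ⟨
    ΣS n g      ∎

  ΣS-cong : ∀ n {f g} → (∀ i → f i ≈S g i) → ΣS n f ≈S ΣS n g
  ΣS-cong n f≈g = ΣS-cong-< n λ i _ → f≈g i

  ΣS-distrib-⊕ : ∀ n f g → ΣS n (λ i → f i ⊕ g i) ≈S ΣS n f ⊕ ΣS n g
  ΣS-distrib-⊕ n f g = begin
    ΣS n (λ i → f i ⊕ g i)   ≡⟨ ΣS≡Σ n _ ⟩
    Sums.Σ n (λ i → f i ⊕ g i) ≈⟨ Sums.Σ-distrib-+ n f g ⟩
    Sums.Σ n f ⊕ Sums.Σ n g  ≡⟨ ≡.cong₂ _⊕_ (ΣS≡Σ n f) (ΣS≡Σ n g) ⟨
    ΣS n f ⊕ ΣS n g          ∎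

  ⊛-distribˡ-ΣS : ∀ n a f → a ⊛ ΣS n f ≈S ΣS n (λ i → a ⊛ f i)
  ⊛-distribˡ-ΣS n a f = begin
    a ⊛ ΣS n f                ≡⟨ ≡.cong (a ⊛_) (ΣS≡Σ n f) ⟩
    a ⊛ Sums.Σ n f            ≈⟨ Sums.*-distribˡ-Σ n a f ⟩
    Sums.Σ n (λ i → a ⊛ f i)  ≡⟨ ΣS≡Σ n _ ⟨
    ΣS n (λ i → a ⊛ f i)      ∎

  ΣS-head : ∀ n f → ΣS (suc n) f ≈S f 0 ⊕ ΣS n (λ i → f (suc i))
  ΣS-head n f = begin
    ΣS (suc n) f                      ≡⟨ ΣS≡Σ (suc n) f ⟩
    Sums.Σ (suc n) f                  ≈⟨ Sums.Σ-head n f ⟩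
    f 0 ⊕ Sums.Σ n (λ i → f (suc i))  ≡⟨ ≡.cong (f 0 ⊕_) (ΣS≡Σ n _) ⟨
    f 0 ⊕ ΣS n (λ i → f (suc i))      ∎

  xpow : ℕ → Ser
  xpow k = mono k 0 0

  xpow-+ : ∀ i j → xpow i ⊛ xpow j ≈S xpow (i + j)
  xpow-+ i j = coeffs λ a b c → ≡.trans (mono-⊛ i 0 0 (xpow j) a b c)
    (≡.trans (guard a b c (i ≤ᵇ a)) (≡.cong (λ z → when (z ∧ (0 ≡ᵇ b) ∧ (0 ≡ᵇ c)) 1ℤ) (≡.sym (+-≡ᵇ i j a))))
    where
    guard : ∀ a b c bb → when bb (when ((j ≡ᵇ a ∸ i) ∧ (0 ≡ᵇ b) ∧ (0 ≡ᵇ c)) 1ℤ)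
                         ≡.≡ when ((bb ∧ (j ≡ᵇ a ∸ i)) ∧ (0 ≡ᵇ b) ∧ (0 ≡ᵇ c)) 1ℤ
    guard a b c true  = ≡.refl
    guard a b c false = ≡.refl

  [1-x]⊛geomX : (oneS ⊖ xS) ⊛ geomX ≈S oneS
  [1-x]⊛geomX = begin
    (oneS ⊖ xS) ⊛ geomX          ≈⟨ solve 3 (λ o x g → (o :- x) :* g := o :* g :- x :* g) refl oneS xS geomX ⟩
    oneS ⊛ geomX ⊖ xS ⊛ geomX    ≈⟨ ⊕-congʳ (⊝ (xS ⊛ geomX)) (*-identityˡ geomX) ⟩
    geomX ⊖ xS ⊛ geomX           ≈⟨ coeffs telescope ⟩
    oneS                         ∎
    where
    telescope : ∀ a b c → (geomX ⊖ xS ⊛ geomX) a b c ≡.≡ oneS a b c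
    telescope zero    b c = ≡.trans (≡.cong (λ z → geomX 0 b c +ℤ -ℤ z) (mono-⊛ 1 0 0 geomX 0 b c))
                                    (≡.trans (ℤ.+-identityʳ _) (geomX-0 b c))
      where
      geomX-0 : ∀ b c → geomX 0 b c ≡.≡ oneS 0 b c
      geomX-0 zero    zero    = ≡.refl
      geomX-0 zero    (suc c) = ≡.refl
      geomX-0 (suc b) c       = ≡.refl
    telescope (suc a) b c = ≡.trans (≡.cong (λ z → geomX (suc a) b c +ℤ -ℤ z) (mono-⊛ 1 0 0 geomX (suc a) b c))
                                    (ℤ.+-inverseʳ (geomX a b c))

  -- An identity that holds only modulo relations r ≈ 0 is obtained from the solver with
  -- multiples of the r's as extra summands, which these lemmas then discard.
  ⊖-null : ∀ {a b} → a ≈S b → a ⊖ b ≈S zeroS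
  ⊖-null {a} a≈b = trans (⊕-congˡ a (-‿cong (sym a≈b))) (-‿inverseʳ a)

  ⊛-null : ∀ a {r} → r ≈S zeroS → a ⊛ r ≈S zeroS
  ⊛-null a r≈0 = trans (⊛-congˡ a r≈0) (zeroʳ a)

  ⊕-null : ∀ {r s} → r ≈S zeroS → s ≈S zeroS → r ⊕ s ≈S zeroS
  ⊕-null r≈0 s≈0 = trans (+-cong r≈0 s≈0) (+-identityʳ zeroS)

  ⊕-nullʳ : ∀ a {r} → r ≈S zeroS → a ⊕ r ≈S a
  ⊕-nullʳ a r≈0 = trans (⊕-congˡ a r≈0) (+-identityʳ a)

  geomX-null : oneS ⊖ (oneS ⊖ xS) ⊛ geomX ≈S zeroS
  geomX-null = ⊖-null (sym [1-x]⊛geomX)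

  xpow-null : ∀ k → xpow (suc k) ⊖ xS ⊛ xpow k ≈S zeroS
  xpow-null k = ⊖-null (sym (xpow-+ 1 k))


module Exponents where

  open import Data.Nat using (ℕ; zero; suc; _+_; _*_; _∸_; _≤_; _<_; z≤n)
  open import Data.Nat.Properties
  open import Data.Nat.Combinatorics using (_C_; nC1≡n; nCk+nC[k+1]≡[n+1]C[k+1])
  open import Data.Nat.Tactic.RingSolver using (solve-∀)
  open import Relation.Binary.PropositionalEquality using (_≡_; refl; sym; trans; cong; cong₂; module ≡-Reasoning)

  Nexp : ℕ → ℕ → ℕ
  Nexp m j = m * j ∸ j C 2

  C2-suc : ∀ j → suc j C 2 ≡ j + j C 2
  C2-suc j = trans (sym (nCk+nC[k+1]≡[n+1]C[k+1] j 1)) (cong (_+ j C 2) (nC1≡n j))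

  C2≤* : ∀ {j m} → j ≤ m → j C 2 ≤ m * j
  C2≤* {zero}  j≤m = z≤n
  C2≤* {suc j} {m} j<m = begin
    suc j C 2      ≡⟨ C2-suc j ⟩
    j + j C 2      ≤⟨ +-mono-≤ (<⇒≤ j<m) (C2≤* (<⇒≤ j<m)) ⟩
    m + m * j      ≡⟨ *-suc m j ⟨
    m * suc j      ∎
    where open ≤-Reasoning

  [a+c]∸[b+d]≡[a∸b]+[c∸d] : ∀ a b c d → b ≤ a → d ≤ c → (a + c) ∸ (b + d) ≡ (a ∸ b) + (c ∸ d)
  [a+c]∸[b+d]≡[a∸b]+[c∸d] a b c d b≤a d≤c = begin
    (a + c) ∸ (b + d)    ≡⟨ ∸-+-assoc (a + c) b d ⟨
    (a + c) ∸ b ∸ d      ≡⟨ cong (_∸ d) (+-∸-comm c b≤a) ⟩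
    (a ∸ b + c) ∸ d      ≡⟨ +-∸-assoc (a ∸ b) d≤c ⟩
    (a ∸ b) + (c ∸ d)    ∎
    where open ≡-Reasoning

  Nexp-zero : ∀ m → Nexp m 0 ≡ 0
  Nexp-zero m = cong (_∸ 0) (*-zeroʳ m)

  Nexp-suc : ∀ m j → j < m → Nexp m (suc j) ≡ (m ∸ j) + Nexp m j
  Nexp-suc m j j<m = begin
    m * suc j ∸ suc j C 2      ≡⟨ cong₂ _∸_ (*-suc m j) (C2-suc j) ⟩
    (m + m * j) ∸ (j + j C 2)  ≡⟨ [a+c]∸[b+d]≡[a∸b]+[c∸d] m j (m * j) (j C 2) (<⇒≤ j<m) (C2≤* (<⇒≤ j<m)) ⟩
    (m ∸ j) + Nexp m j         ∎
    where open ≡-Reasoning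

  Nexp-suc-suc : ∀ m j → j ≤ m → Nexp (suc m) (suc j) ≡ suc m + Nexp m j
  Nexp-suc-suc m j j≤m = begin
    suc m * suc j ∸ suc j C 2          ≡⟨ cong₂ _∸_ (expand m j) (C2-suc j) ⟩
    (j + (suc m + m * j)) ∸ (j + j C 2) ≡⟨ [m+n]∸[m+o]≡n∸o j (suc m + m * j) (j C 2) ⟩
    (suc m + m * j) ∸ j C 2            ≡⟨ +-∸-assoc (suc m) (C2≤* j≤m) ⟩
    suc m + Nexp m j                   ∎
    where
    open ≡-Reasoning
    expand : ∀ m j → suc m * suc j ≡ j + (suc m + m * j)
    expand = solve-∀

  C2+C2+n≡n*n : ∀ n → n C 2 + n C 2 + n ≡ n * n
  C2+C2+n≡n*n zero    = refl
  C2+C2+n≡n*n (suc n) = begin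
    suc n C 2 + suc n C 2 + suc n               ≡⟨ cong (λ k → k + k + suc n) (C2-suc n) ⟩
    (n + n C 2) + (n + n C 2) + suc n           ≡⟨ regroup n (n C 2) ⟩
    (n C 2 + n C 2 + n) + (n + n + 1)           ≡⟨ cong (_+ (n + n + 1)) (C2+C2+n≡n*n n) ⟩
    n * n + (n + n + 1)                         ≡⟨ square n ⟩
    suc n * suc n                               ∎
    where
    open ≡-Reasoning
    regroup : ∀ n c → (n + c) + (n + c) + suc n ≡ (c + c + n) + (n + n + 1)
    regroup = solve-∀
    square : ∀ n → n * n + (n + n + 1) ≡ suc n * suc n
    square = solve-∀

  Nexp-diagonal : ∀ m → suc m C 2 ≡ Nexp m m
  Nexp-diagonal m = begin
    suc m C 2                  ≡⟨ C2-suc m ⟩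
    m + m C 2                  ≡⟨ m+n∸n≡m (m + m C 2) (m C 2) ⟨
    m + m C 2 + m C 2 ∸ m C 2  ≡⟨ cong (_∸ m C 2) (trans (swap m (m C 2)) (C2+C2+n≡n*n m)) ⟩
    m * m ∸ m C 2              ∎
    where
    open ≡-Reasoning
    swap : ∀ m c → m + c + c ≡ c + c + m
    swap = solve-∀


module NTerms where

  open import Defs
  open SeriesRing using (serRing; _≈S_)
  open SeriesSolver using (solve; _:=_; _:*_)
  open SeriesFacts
  open Exponents
  open import Data.Nat using (ℕ; suc; _+_; _≤_)
  open import Data.Nat.Properties using (≤-trans)
  open import Data.Nat.Combinatorics using (_C_)
  open import Relation.Binary.PropositionalEquality using (_≡_; cong)
  open import Algebra.Bundles using (CommutativeRing)

  open CommutativeRing serRing using (setoid; refl; sym; trans; reflexive; *-identityʳ)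
  open import Relation.Binary.Reasoning.Setoid setoid

  Nterm : ℕ → ℕ → Ser
  Nterm m j = xpow (Nexp m j) ⊛ powS u j

  Npartial : ℕ → ℕ → Ser
  Npartial m k = ΣS k (Nterm m)

  Nterm-zero : ∀ m → Nterm m 0 ≈S oneS
  Nterm-zero m = trans (⊛-congʳ oneS (reflexive (cong xpow (Nexp-zero m)))) (*-identityʳ oneS)

  Nterm-shift : ∀ m m′ j k → Nexp m (suc j) ≡ k + Nexp m′ j → Nterm m (suc j) ≈S xpow k ⊛ u ⊛ Nterm m′ j
  Nterm-shift m m′ j k e = begin
    xpow (Nexp m (suc j)) ⊛ (u ⊛ powS u j)
      ≈⟨ ⊛-congʳ (u ⊛ powS u j) (trans (reflexive (cong xpow e)) (sym (xpow-+ k (Nexp m′ j)))) ⟩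
    (xpow k ⊛ xpow (Nexp m′ j)) ⊛ (u ⊛ powS u j)
      ≈⟨ solve 4 (λ a b c d → (a :* b) :* (c :* d) := a :* c :* (b :* d)) refl (xpow k) (xpow (Nexp m′ j)) u (powS u j) ⟩
    xpow k ⊛ u ⊛ Nterm m′ j ∎

  Nterm-diagonal : ∀ m → mono (suc m C 2) 0 0 ⊛ powS u m ≈S Nterm m m
  Nterm-diagonal m = ⊛-congʳ (powS u m) (reflexive (cong xpow (Nexp-diagonal m)))

  Npartial-suc : ∀ m k → k ≤ suc m → Npartial (suc m) (suc k) ≈S oneS ⊕ xpow (suc m) ⊛ u ⊛ Npartial m k
  Npartial-suc m k k≤1+m = begin
    ΣS (suc k) (Nterm (suc m))
      ≈⟨ ΣS-head k (Nterm (suc m)) ⟩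
    Nterm (suc m) 0 ⊕ ΣS k (λ j → Nterm (suc m) (suc j))
      ≈⟨ +-cong (Nterm-zero (suc m)) (ΣS-cong-< k λ j j<k →
           Nterm-shift (suc m) m j (suc m) (Nexp-suc-suc m j (≤-pred (≤-trans j<k k≤1+m)))) ⟩
    oneS ⊕ ΣS k (λ j → xpow (suc m) ⊛ u ⊛ Nterm m j)
      ≈⟨ ⊕-congˡ oneS (⊛-distribˡ-ΣS k (xpow (suc m) ⊛ u) (Nterm m)) ⟨
    oneS ⊕ xpow (suc m) ⊛ u ⊛ Npartial m k ∎
    where
    open CommutativeRing serRing using (+-cong)
    open Data.Nat.Properties using (≤-pred)


module StateSeries where

  open import Defs
  open Staircase using (Σℕ; bit; step; completes; completes-below; ≤ᵇ-true; ≤ᵇ-false; ≡ᵇ-refl; ≡ᵇ-false)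
  open Counting using (compositionCount)
  open SeriesRing using (serRing; _≈S_; coeffs; coeff; Σ<-cong; Σ<-head)
  open Coefficients using (when; mono-⊛; geomX-⊛)
  open SeriesFacts
  open SeriesSolver using (solve; _:=_; _:+_; _:*_)
  open import Data.Bool using (Bool; true; false; _∧_; if_then_else_)
  open import Data.Bool.Properties using (∧-zeroʳ)
  open import Data.Nat using (ℕ; zero; suc; _+_; _∸_; _≤_; _<_; z≤n; s≤s; _≤ᵇ_; _≡ᵇ_)
  open import Data.Nat.Properties using (≤-refl; <⇒≤)
  open import Data.Integer using (ℤ; 0ℤ; 1ℤ; +_) renaming (_+_ to _+ℤ_)
  import Data.Integer.Properties as ℤ
  import Relation.Binary.PropositionalEquality as ≡
  open import Algebra.Bundles using (CommutativeRing)

  open CommutativeRing serRing using (setoid; refl; sym; trans; reflexive; *-assoc; +-identityˡ)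
  open import Relation.Binary.Reasoning.Setoid setoid

  H : ℕ → ℕ → Ser
  H m′ t a b c = + compositionCount m′ t a b c

  -- Σ_{a ≥ 1} x^a K a
  sumParts : (ℕ → Ser) → Ser
  sumParts K a b c = Σ< a (λ i → K (suc i) (a ∸ suc i) b c)

  afterPart : ℕ → ℕ → ℕ → Ser
  afterPart m′ t a = if completes m′ t a then qS ⊛ H m′ (step m′ t a) else H m′ (step m′ t a)

  H-first-part : ∀ m′ t → H m′ t ≈S oneS ⊕ yS ⊛ sumParts (afterPart m′ t)
  H-first-part m′ t = coeffs coefficient
    where
    +-bit : ∀ bb → + bit bb ≡.≡ when bb 1ℤ
    +-bit true  = ≡.refl
    +-bit false = ≡.refl
    +-if : ∀ bb {n} → + (if bb then n else 0) ≡.≡ when bb (+ n)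
    +-if true  = ≡.refl
    +-if false = ≡.refl
    +-Σℕ : ∀ n f → + Σℕ n f ≡.≡ Σ< n (λ i → + f i)
    +-Σℕ zero    f = ≡.refl
    +-Σℕ (suc n) f = ≡.cong (_+ℤ + f n) (+-Σℕ n f)
    coefficient : ∀ a b c → H m′ t a b c ≡.≡ (oneS ⊕ yS ⊛ sumParts (afterPart m′ t)) a b c
    coefficient a zero c = ≡.trans (+-bit ((0 ≡ᵇ a) ∧ (0 ≡ᵇ c))) (≡.sym (≡.trans (≡.cong (oneS a 0 c +ℤ_) (mono-⊛ 0 1 0 (sumParts (afterPart m′ t)) a 0 c))
                                                         (ℤ.+-identityʳ _)))
    coefficient a (suc b) c = ≡.trans (+-Σℕ a _) (≡.sym (≡.trans (≡.cong₂ _+ℤ_ no-constant-term (mono-⊛ 0 1 0 (sumParts (afterPart m′ t)) a (suc b) c))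
                                                              (≡.trans (ℤ.+-identityˡ _) (Σ<-cong a λ i → ≡.sym (part i)))))
      where
      no-constant-term : oneS a (suc b) c ≡.≡ 0ℤ
      no-constant-term = ≡.cong (λ bb → when bb 1ℤ) (∧-zeroʳ (0 ≡ᵇ a))
      part : ∀ i → + (let d = bit (completes m′ t (suc i)) in
                      if d ≤ᵇ c then compositionCount m′ (step m′ t (suc i)) (a ∸ suc i) b (c ∸ d) else 0)
                   ≡.≡ afterPart m′ t (suc i) (a ∸ suc i) b c
      part i with completes m′ t (suc i)
      ... | false = ≡.refl
      ... | true  = ≡.trans (+-if (1 ≤ᵇ c)) (≡.sym (mono-⊛ 0 0 1 (H m′ (step m′ t (suc i))) (a ∸ suc i) b c))

  sumParts-head : ∀ K → sumParts K ≈S xS ⊛ K 1 ⊕ xS ⊛ sumParts (λ a → K (suc a))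
  sumParts-head K = coeffs coefficient
    where
    coefficient : ∀ a b c → sumParts K a b c ≡.≡ (xS ⊛ K 1 ⊕ xS ⊛ sumParts (λ a → K (suc a))) a b c
    coefficient zero    b c = ≡.sym (≡.cong₂ _+ℤ_ (mono-⊛ 1 0 0 (K 1) 0 b c)
                                                 (mono-⊛ 1 0 0 (sumParts (λ a → K (suc a))) 0 b c))
    coefficient (suc a) b c = ≡.trans (Σ<-head a (λ i → K (suc i) (suc a ∸ suc i) b c))
      (≡.sym (≡.cong₂ _+ℤ_ (mono-⊛ 1 0 0 (K 1) (suc a) b c) (mono-⊛ 1 0 0 (sumParts (λ a → K (suc a))) (suc a) b c)))

  sumParts-const : ∀ K G → (∀ a → K (suc a) ≈S G) → sumParts K ≈S xS ⊛ (geomX ⊛ G)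
  sumParts-const K G K≈G = coeffs coefficient
    where
    coefficient : ∀ a b c → sumParts K a b c ≡.≡ (xS ⊛ (geomX ⊛ G)) a b c
    coefficient zero    b c = ≡.sym (mono-⊛ 1 0 0 (geomX ⊛ G) 0 b c)
    coefficient (suc a) b c = ≡.trans (Σ<-cong (suc a) (λ i → coeff (K≈G i) (a ∸ i) b c))
      (≡.sym (≡.trans (mono-⊛ 1 0 0 (geomX ⊛ G) (suc a) b c) (geomX-⊛ G a b c)))

  lowerParts : (ℕ → Ser) → ℕ → Ser
  lowerParts K t = ΣS t (λ i → xpow (suc i) ⊛ K (suc i))

  Recurrence : (ℕ → Ser) → ℕ → Ser → Set
  Recurrence Hs t G = Hs t ≈S oneS ⊕ yS ⊛ (lowerParts Hs t ⊕ xpow (suc t) ⊛ geomX ⊛ G)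

  sumParts-split : ∀ t K G → (∀ a → t < a → K a ≈S G) →
    sumParts K ≈S lowerParts K t ⊕ xpow (suc t) ⊛ geomX ⊛ G
  sumParts-split zero    K G K≈G = begin
    sumParts K                  ≈⟨ sumParts-const K G (λ a → K≈G (suc a) (s≤s z≤n)) ⟩
    xS ⊛ (geomX ⊛ G)            ≈⟨ *-assoc xS geomX G ⟨
    xS ⊛ geomX ⊛ G              ≈⟨ +-identityˡ _ ⟨
    zeroS ⊕ xS ⊛ geomX ⊛ G      ∎
  sumParts-split (suc t) K G K≈G = begin
    sumParts K
      ≈⟨ sumParts-head K ⟩
    xS ⊛ K 1 ⊕ xS ⊛ sumParts K′
      ≈⟨ ⊕-congˡ (xS ⊛ K 1) (⊛-congˡ xS (sumParts-split t K′ G (λ a t<a → K≈G (suc a) (s≤s t<a)))) ⟩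
    xS ⊛ K 1 ⊕ xS ⊛ (lowerParts K′ t ⊕ xpow (suc t) ⊛ geomX ⊛ G)
      ≈⟨ solve 6 (λ x K₁ S X g G → x :* K₁ :+ x :* (S :+ X :* g :* G) := x :* K₁ :+ x :* S :+ x :* X :* g :* G)
           refl xS (K 1) (lowerParts K′ t) (xpow (suc t)) geomX G ⟩
    xS ⊛ K 1 ⊕ xS ⊛ lowerParts K′ t ⊕ xS ⊛ xpow (suc t) ⊛ geomX ⊛ G
      ≈⟨ +-cong (⊕-congˡ (xS ⊛ K 1) (trans (⊛-distribˡ-ΣS t xS (λ i → xpow (suc i) ⊛ K′ (suc i)))
                                           (ΣS-cong t λ i → x-times (xpow (suc i)) (K′ (suc i)) (xpow-+ 1 (suc i)))))
                (⊛-congʳ G (⊛-congʳ geomX (xpow-+ 1 (suc t)))) ⟩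
    xS ⊛ K 1 ⊕ ΣS t (λ i → xpow (suc (suc i)) ⊛ K (suc (suc i))) ⊕ xpow (suc (suc t)) ⊛ geomX ⊛ G
      ≈⟨ ⊕-congʳ (xpow (suc (suc t)) ⊛ geomX ⊛ G) (ΣS-head t (λ i → xpow (suc i) ⊛ K (suc i))) ⟨
    lowerParts K (suc t) ⊕ xpow (suc (suc t)) ⊛ geomX ⊛ G ∎
    where
    K′ : ℕ → Ser
    K′ a = K (suc a)
    open CommutativeRing serRing using (+-cong)
    x-times : ∀ X Y {Z} → xS ⊛ X ≈S Z → xS ⊛ (X ⊛ Y) ≈S Z ⊛ Y
    x-times X Y xX≈Z = trans (sym (*-assoc xS X Y)) (⊛-congʳ Y xX≈Z)

  afterPart-≤ : ∀ m′ t a → a ≤ t → t ≤ m′ → afterPart m′ t a ≡.≡ H m′ a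
  afterPart-≤ m′ t a a≤t t≤m′ = ≡.cong₂ (λ done s → if done then qS ⊛ H m′ s else H m′ s)
    (completes-below m′ t a a≤t t≤m′)
    (≡.cong (λ bb → if bb then a else (if t ≡ᵇ m′ then m′ else suc t)) (≤ᵇ-true a≤t))

  afterPart-> : ∀ m′ t a → t < m′ → t < a → afterPart m′ t a ≡.≡ H m′ (suc t)
  afterPart-> m′ t a t<m′ t<a rewrite ≡ᵇ-false t<m′ | ≤ᵇ-false t<a = ≡.refl

  afterPart-top : ∀ m′ a → m′ < a → afterPart m′ m′ a ≡.≡ qS ⊛ H m′ m′
  afterPart-top m′ a m′<a rewrite ≡ᵇ-refl m′ | ≤ᵇ-true m′<a | ≤ᵇ-false m′<a = ≡.refl

  H-rec : ∀ m′ t G → t ≤ m′ → (∀ a → t < a → afterPart m′ t a ≈S G) → Recurrence (H m′) t G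
  H-rec m′ t G t≤m′ above = begin
    H m′ t
      ≈⟨ H-first-part m′ t ⟩
    oneS ⊕ yS ⊛ sumParts (afterPart m′ t)
      ≈⟨ ⊕-congˡ oneS (⊛-congˡ yS (sumParts-split t (afterPart m′ t) G above)) ⟩
    oneS ⊕ yS ⊛ (lowerParts (afterPart m′ t) t ⊕ xpow (suc t) ⊛ geomX ⊛ G)
      ≈⟨ ⊕-congˡ oneS (⊛-congˡ yS (⊕-congʳ (xpow (suc t) ⊛ geomX ⊛ G) (ΣS-cong-< t λ i i<t →
           ⊛-congˡ (xpow (suc i)) (reflexive (afterPart-≤ m′ t (suc i) i<t t≤m′))))) ⟩
    oneS ⊕ yS ⊛ (lowerParts (H m′) t ⊕ xpow (suc t) ⊛ geomX ⊛ G) ∎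

  H-rec-< : ∀ m′ t → t < m′ → Recurrence (H m′) t (H m′ (suc t))
  H-rec-< m′ t t<m′ = H-rec m′ t (H m′ (suc t)) (<⇒≤ t<m′) λ a t<a → reflexive (afterPart-> m′ t a t<m′ t<a)

  H-rec-top : ∀ m′ → Recurrence (H m′) m′ (qS ⊛ H m′ m′)
  H-rec-top m′ = H-rec m′ m′ (qS ⊛ H m′ m′) ≤-refl λ a m′<a → reflexive (afterPart-top m′ a m′<a)


module LinearSystem where

  open import Defs
  open SeriesRing using (serRing; _≈S_)
  open SeriesSolver using (solve; _:=_; _:+_; _:*_; _:-_; :-_; con)
  open SeriesFacts
  open NTerms
  open Exponents using (Nexp; Nexp-suc)
  open StateSeries using (lowerParts; Recurrence)
  open import Data.Nat using (ℕ; zero; suc; _+_; _∸_; _≤_; _<_; z≤n; s≤s)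
  open import Data.Nat.Properties using (≤-refl; ≤-trans; n≤1+n; +-suc; +-identityʳ; +-comm; m+[n∸m]≡n; m≤n+m; m<m+n; m+n∸n≡m)
  open import Data.Integer using (1ℤ)
  import Relation.Binary.PropositionalEquality as ≡
  open import Algebra.Bundles using (CommutativeRing)

  open CommutativeRing serRing using (setoid; refl; sym; trans; +-cong; -‿cong; +-identityˡ; *-identityʳ)
  open import Relation.Binary.Reasoning.Setoid setoid

  -- Solutions of the recurrences H-rec-< and H-rec-top satisfy Hs t ≈ Hs n ⊛ P n (n ∸ t) and
  -- Hs n ⊛ Q n ≈ 1.
  P : ℕ → ℕ → Ser
  P n k = qS ⊕ (oneS ⊖ qS) ⊛ Npartial (suc n) (suc k)

  W : ℕ → Ser
  W n = ΣS n (λ i → xpow (suc i) ⊛ P n (n ∸ suc i))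

  Q : ℕ → Ser
  Q n = oneS ⊖ yS ⊛ W n ⊖ yS ⊛ xpow (suc n) ⊛ geomX ⊛ qS

  difference-top : ∀ Hs t → Recurrence Hs t (Hs (suc t)) → Recurrence Hs (suc t) (qS ⊛ Hs (suc t)) →
    Hs (suc t) ⊖ Hs t ≈S ⊝ ((oneS ⊖ qS) ⊛ Hs (suc t) ⊛ Nterm (suc (suc t)) 1)
  difference-top Hs t rec-t rec-top = begin
    Hs (suc t) ⊖ Hs t
      ≈⟨ +-cong rec-top (-‿cong rec-t) ⟩
    (oneS ⊕ yS ⊛ (S ⊕ X₁ ⊛ E ⊕ X₂ ⊛ geomX ⊛ (qS ⊛ E))) ⊖ (oneS ⊕ yS ⊛ (S ⊕ X₁ ⊛ geomX ⊛ E))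
      ≈⟨ solve 8 (λ y S X₁ E X₂ g q x →
           (con 1ℤ :+ y :* (S :+ X₁ :* E :+ X₂ :* g :* (q :* E))) :- (con 1ℤ :+ y :* (S :+ X₁ :* g :* E))
           := :- ((con 1ℤ :- q) :* E :* (X₂ :* (y :* g)))
              :+ (y :* X₁ :* E :* (con 1ℤ :- (con 1ℤ :- x) :* g) :+ E :* y :* g :* (X₂ :- x :* X₁)))
           refl yS S X₁ E X₂ geomX qS xS ⟩
    ⊝ ((oneS ⊖ qS) ⊛ E ⊛ (X₂ ⊛ u)) ⊕ (yS ⊛ X₁ ⊛ E ⊛ (oneS ⊖ (oneS ⊖ xS) ⊛ geomX) ⊕ E ⊛ yS ⊛ geomX ⊛ (X₂ ⊖ xS ⊛ X₁))
      ≈⟨ ⊕-nullʳ (⊝ ((oneS ⊖ qS) ⊛ E ⊛ (X₂ ⊛ u))) (⊕-null (⊛-null (yS ⊛ X₁ ⊛ E) geomX-null) (⊛-null (E ⊛ yS ⊛ geomX) (xpow-null (suc t)))) ⟩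
    ⊝ ((oneS ⊖ qS) ⊛ E ⊛ (X₂ ⊛ u))
      ≈⟨ -‿cong (⊛-congˡ ((oneS ⊖ qS) ⊛ E) (sym (trans (Nterm-shift (suc (suc t)) (suc (suc t)) 0 (suc (suc t))
                                                    (Nexp-suc (suc (suc t)) 0 (s≤s z≤n)))
                                                  (trans (⊛-congˡ (X₂ ⊛ u) (Nterm-zero (suc (suc t)))) (*-identityʳ (X₂ ⊛ u)))))) ⟩
    ⊝ ((oneS ⊖ qS) ⊛ E ⊛ Nterm (suc (suc t)) 1) ∎
    where
    E  = Hs (suc t)
    S  = lowerParts Hs t
    X₁ = xpow (suc t)
    X₂ = xpow (suc (suc t))

  difference-below : ∀ Hs t → Recurrence Hs t (Hs (suc t)) → Recurrence Hs (suc t) (Hs (suc (suc t))) →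
    Hs (suc t) ⊖ Hs t ≈S xpow (suc (suc t)) ⊛ u ⊛ (Hs (suc (suc t)) ⊖ Hs (suc t))
  difference-below Hs t rec-t rec-1+t = begin
    H₁ ⊖ H₀
      ≈⟨ +-cong rec-1+t (-‿cong rec-t) ⟩
    (oneS ⊕ yS ⊛ (S ⊕ X₁ ⊛ H₁ ⊕ X₂ ⊛ geomX ⊛ H₂)) ⊖ (oneS ⊕ yS ⊛ (S ⊕ X₁ ⊛ geomX ⊛ H₁))
      ≈⟨ solve 8 (λ y S X₁ H₁ X₂ g H₂ x →
           (con 1ℤ :+ y :* (S :+ X₁ :* H₁ :+ X₂ :* g :* H₂)) :- (con 1ℤ :+ y :* (S :+ X₁ :* g :* H₁))
           := X₂ :* (y :* g) :* (H₂ :- H₁)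
              :+ (y :* X₁ :* H₁ :* (con 1ℤ :- (con 1ℤ :- x) :* g) :+ y :* g :* H₁ :* (X₂ :- x :* X₁)))
           refl yS S X₁ H₁ X₂ geomX H₂ xS ⟩
    X₂ ⊛ u ⊛ (H₂ ⊖ H₁) ⊕ (yS ⊛ X₁ ⊛ H₁ ⊛ (oneS ⊖ (oneS ⊖ xS) ⊛ geomX) ⊕ yS ⊛ geomX ⊛ H₁ ⊛ (X₂ ⊖ xS ⊛ X₁))
      ≈⟨ ⊕-nullʳ (X₂ ⊛ u ⊛ (H₂ ⊖ H₁)) (⊕-null (⊛-null (yS ⊛ X₁ ⊛ H₁) geomX-null)
                                              (⊛-null (yS ⊛ geomX ⊛ H₁) (xpow-null (suc t)))) ⟩
    X₂ ⊛ u ⊛ (H₂ ⊖ H₁) ∎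
    where
    H₀ = Hs t
    H₁ = Hs (suc t)
    H₂ = Hs (suc (suc t))
    S  = lowerParts Hs t
    X₁ = xpow (suc t)
    X₂ = xpow (suc (suc t))

  P-zero : ∀ n → P n 0 ≈S oneS
  P-zero n = begin
    qS ⊕ (oneS ⊖ qS) ⊛ (zeroS ⊕ Nterm (suc n) 0)
      ≈⟨ ⊕-congˡ qS (⊛-congˡ (oneS ⊖ qS) (trans (+-identityˡ _) (Nterm-zero (suc n)))) ⟩
    qS ⊕ (oneS ⊖ qS) ⊛ oneS
      ≈⟨ solve 1 (λ q → q :+ (con 1ℤ :- q) :* con 1ℤ := con 1ℤ) refl qS ⟩
    oneS ∎

  module Solution (n : ℕ) (Hs : ℕ → Ser)
    (rec-< : ∀ t → t < n → Recurrence Hs t (Hs (suc t)))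
    (rec-top : Recurrence Hs n (qS ⊛ Hs n)) where

    difference : ∀ d t → t + suc d ≡.≡ n → Hs (suc t) ⊖ Hs t ≈S ⊝ ((oneS ⊖ qS) ⊛ Hs n ⊛ Nterm (suc n) (suc d))
    difference zero t t+1≡n = ≡.subst (λ k → Hs (suc t) ⊖ Hs t ≈S ⊝ ((oneS ⊖ qS) ⊛ Hs k ⊛ Nterm (suc k) 1)) 1+t≡n
      (difference-top Hs t (rec-< t (≡.subst (t <_) 1+t≡n ≤-refl))
                           (≡.subst (λ k → Recurrence Hs k (qS ⊛ Hs k)) (≡.sym 1+t≡n) rec-top))
      where
      1+t≡n : suc t ≡.≡ n
      1+t≡n = ≡.trans (+-comm 1 t) t+1≡n
    difference (suc d) t t+2+d≡n = begin
      Hs (suc t) ⊖ Hs t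
        ≈⟨ difference-below Hs t (rec-< t t<n) (rec-< (suc t) 1+t<n) ⟩
      X₂ ⊛ u ⊛ (Hs (suc (suc t)) ⊖ Hs (suc t))
        ≈⟨ ⊛-congˡ (X₂ ⊛ u) (difference d (suc t) (≡.trans (≡.sym (+-suc t (suc d))) t+2+d≡n)) ⟩
      X₂ ⊛ u ⊛ ⊝ ((oneS ⊖ qS) ⊛ Hs n ⊛ τ)
        ≈⟨ solve 5 (λ X u q E τ → X :* u :* (:- ((con 1ℤ :- q) :* E :* τ)) := :- ((con 1ℤ :- q) :* E :* (X :* u :* τ)))
             refl X₂ u qS (Hs n) τ ⟩
      ⊝ ((oneS ⊖ qS) ⊛ Hs n ⊛ (X₂ ⊛ u ⊛ τ))
        ≈⟨ -‿cong (⊛-congˡ ((oneS ⊖ qS) ⊛ Hs n) (sym (Nterm-shift (suc n) (suc n) (suc d) (suc (suc t)) exponent))) ⟩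
      ⊝ ((oneS ⊖ qS) ⊛ Hs n ⊛ Nterm (suc n) (suc (suc d))) ∎
      where
      X₂ = xpow (suc (suc t))
      τ  = Nterm (suc n) (suc d)
      t<n : t < n
      t<n = ≡.subst (t <_) t+2+d≡n (m<m+n t (s≤s z≤n))
      1+t<n : suc t < n
      1+t<n = ≡.subst (suc t <_) (≡.trans (≡.sym (+-suc t (suc d))) t+2+d≡n) (m<m+n (suc t) (s≤s z≤n))
      n≡2+t+d : n ≡.≡ suc (suc t) + d
      n≡2+t+d = ≡.trans (≡.sym t+2+d≡n) (≡.trans (+-suc t (suc d)) (≡.cong suc (+-suc t d)))
      exponent : Nexp (suc n) (suc (suc d)) ≡.≡ suc (suc t) + Nexp (suc n) (suc d)
      exponent = ≡.trans (Nexp-suc (suc n) (suc d) (s≤s (≡.subst (suc d ≤_) t+2+d≡n (≤-trans (n≤1+n (suc d)) (m≤n+m (suc (suc d)) t)))))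
        (≡.cong (_+ Nexp (suc n) (suc d)) (≡.trans (≡.cong (_∸ d) n≡2+t+d) (m+n∸n≡m (suc (suc t)) d)))

    Hs-as-P : ∀ k t → t + k ≡.≡ n → Hs t ≈S Hs n ⊛ P n k
    Hs-as-P zero t t+0≡n = ≡.subst (λ k → Hs t ≈S Hs k ⊛ P k 0) (≡.trans (≡.sym (+-identityʳ t)) t+0≡n)
      (sym (trans (⊛-congˡ (Hs t) (P-zero t)) (*-identityʳ (Hs t))))
    Hs-as-P (suc k) t t+1+k≡n = begin
      Hs t
        ≈⟨ solve 2 (λ a b → b := a :- (a :- b)) refl (Hs (suc t)) (Hs t) ⟩
      Hs (suc t) ⊖ (Hs (suc t) ⊖ Hs t)
        ≈⟨ +-cong (Hs-as-P k (suc t) (≡.trans (≡.sym (+-suc t k)) t+1+k≡n)) (-‿cong (difference k t t+1+k≡n)) ⟩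
      Hs n ⊛ P n k ⊖ ⊝ ((oneS ⊖ qS) ⊛ Hs n ⊛ Nterm (suc n) (suc k))
        ≈⟨ solve 4 (λ E q Σ τ → E :* (q :+ (con 1ℤ :- q) :* Σ) :- :- ((con 1ℤ :- q) :* E :* τ)
                                := E :* (q :+ (con 1ℤ :- q) :* (Σ :+ τ)))
             refl (Hs n) qS (Npartial (suc n) (suc k)) (Nterm (suc n) (suc k)) ⟩
      Hs n ⊛ P n (suc k) ∎

    lowerParts-as-W : lowerParts Hs n ≈S Hs n ⊛ W n
    lowerParts-as-W = begin
      ΣS n (λ i → xpow (suc i) ⊛ Hs (suc i))
        ≈⟨ ΣS-cong-< n (λ i i<n → trans (⊛-congˡ (xpow (suc i)) (Hs-as-P (n ∸ suc i) (suc i) (m+[n∸m]≡n i<n)))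
             (solve 3 (λ X E P → X :* (E :* P) := E :* (X :* P)) refl (xpow (suc i)) (Hs n) (P n (n ∸ suc i)))) ⟩
      ΣS n (λ i → Hs n ⊛ (xpow (suc i) ⊛ P n (n ∸ suc i)))
        ≈⟨ ⊛-distribˡ-ΣS n (Hs n) (λ i → xpow (suc i) ⊛ P n (n ∸ suc i)) ⟨
      Hs n ⊛ W n ∎

    Hs⊛Q≈1 : Hs n ⊛ Q n ≈S oneS
    Hs⊛Q≈1 = begin
      E ⊛ Q n
        ≈⟨ solve 6 (λ E y W X g q → E :* (con 1ℤ :- y :* W :- y :* X :* g :* q) := E :- y :* (E :* W :+ X :* g :* (q :* E)))
             refl E yS (W n) X geomX qS ⟩
      E ⊖ yS ⊛ Z
        ≈⟨ ⊕-congʳ (⊝ (yS ⊛ Z)) (trans rec-top (⊕-congˡ oneS (⊛-congˡ yS (⊕-congʳ (X ⊛ geomX ⊛ (qS ⊛ E)) lowerParts-as-W)))) ⟩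
      (oneS ⊕ yS ⊛ Z) ⊖ yS ⊛ Z
        ≈⟨ solve 2 (λ y Z → (con 1ℤ :+ y :* Z) :- y :* Z := con 1ℤ) refl yS Z ⟩
      oneS ∎
      where
      E = Hs n
      X = xpow (suc n)
      Z = E ⊛ W n ⊕ X ⊛ geomX ⊛ (qS ⊛ E)


module ClosedForm where

  open import Defs
  open SeriesRing using (serRing; _≈S_)
  open SeriesSolver using (solve; _:=_; _:+_; _:*_; _:-_; :-_; con)
  open SeriesFacts
  open Exponents using (Nexp-suc-suc)
  open NTerms
  open LinearSystem using (P; W; Q)
  open import Data.Nat using (ℕ; zero; suc; _∸_; _<_; z≤n; s≤s)
  open import Data.Nat.Properties using (≤-refl; ≤-trans; n≤1+n; m∸n≤m; +-∸-assoc; n∸n≡0)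
  open import Data.Nat.Combinatorics using (_C_)
  open import Data.Integer using (1ℤ)
  import Relation.Binary.PropositionalEquality as ≡
  open import Algebra.Bundles using (CommutativeRing)

  open CommutativeRing serRing
    using (setoid; refl; sym; trans; reflexive; +-cong; -‿cong; -‿inverseʳ; zeroʳ; +-identityˡ)
  open import Relation.Binary.Reasoning.Setoid setoid

  Num-as-P : ∀ n → Num (suc n) ≈S P n n
  Num-as-P n = begin
    Num (suc n)
      ≈⟨ solve 5 (λ N q X u N′ → N :- q :* X :* u :* N′
                                := (q :+ (con 1ℤ :- q) :* N) :+ q :* (N :- (con 1ℤ :+ X :* u :* N′)))
           refl (N (suc n)) qS (xpow (suc n)) u (N n) ⟩
    P n n ⊕ qS ⊛ (N (suc n) ⊖ (oneS ⊕ xpow (suc n) ⊛ u ⊛ N n))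
      ≈⟨ ⊕-nullʳ (P n n) (⊛-null qS (⊖-null (Npartial-suc n n (n≤1+n n)))) ⟩
    P n n ∎

  A : ℕ → Ser
  A n = ΣS n (λ i → xpow (suc i))

  B : ℕ → Ser
  B n = ΣS n (λ i → xpow (suc i) ⊛ Npartial (suc n) (n ∸ i))

  [1-x]⊛A : ∀ n → (oneS ⊖ xS) ⊛ A n ≈S xS ⊖ xpow (suc n)
  [1-x]⊛A zero    = trans (zeroʳ (oneS ⊖ xS)) (sym (-‿inverseʳ xS))
  [1-x]⊛A (suc n) = begin
    (oneS ⊖ xS) ⊛ (A n ⊕ xpow (suc n))
      ≈⟨ solve 3 (λ x A X → (con 1ℤ :- x) :* (A :+ X) := (con 1ℤ :- x) :* A :+ X :- x :* X) refl xS (A n) (xpow (suc n)) ⟩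
    (oneS ⊖ xS) ⊛ A n ⊕ xpow (suc n) ⊖ xS ⊛ xpow (suc n)
      ≈⟨ +-cong (⊕-congʳ (xpow (suc n)) ([1-x]⊛A n)) (-‿cong (xpow-+ 1 (suc n))) ⟩
    (xS ⊖ xpow (suc n)) ⊕ xpow (suc n) ⊖ xpow (suc (suc n))
      ≈⟨ solve 3 (λ x X Y → (x :- X) :+ X :- Y := x :- Y) refl xS (xpow (suc n)) (xpow (suc (suc n))) ⟩
    xS ⊖ xpow (suc (suc n)) ∎

  B-suc : ∀ n → B (suc n) ≈S A (suc n) ⊕ xpow (suc (suc n)) ⊛ u ⊛ B n
  B-suc n = begin
    ΣS (suc n) (λ i → xpow (suc i) ⊛ Npartial (suc (suc n)) (suc n ∸ i))
      ≈⟨ ΣS-cong-< (suc n) unfold ⟩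
    ΣS (suc n) (λ i → xpow (suc i) ⊕ Y ⊛ (xpow (suc i) ⊛ Npartial (suc n) (n ∸ i)))
      ≈⟨ ΣS-distrib-⊕ (suc n) (λ i → xpow (suc i)) (λ i → Y ⊛ (xpow (suc i) ⊛ Npartial (suc n) (n ∸ i))) ⟩
    A (suc n) ⊕ ΣS (suc n) (λ i → Y ⊛ (xpow (suc i) ⊛ Npartial (suc n) (n ∸ i)))
      ≈⟨ ⊕-congˡ (A (suc n)) (⊛-distribˡ-ΣS (suc n) Y (λ i → xpow (suc i) ⊛ Npartial (suc n) (n ∸ i))) ⟨
    A (suc n) ⊕ Y ⊛ (B n ⊕ xpow (suc n) ⊛ Npartial (suc n) (n ∸ n))
      ≈⟨ ⊕-congˡ (A (suc n)) (⊛-congˡ Y (⊕-nullʳ (B n) (⊛-null (xpow (suc n))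
           (reflexive (≡.cong (Npartial (suc n)) (n∸n≡0 n)))))) ⟩
    A (suc n) ⊕ Y ⊛ B n ∎
    where
    Y = xpow (suc (suc n)) ⊛ u
    unfold : ∀ i → i < suc n →
      xpow (suc i) ⊛ Npartial (suc (suc n)) (suc n ∸ i) ≈S xpow (suc i) ⊕ Y ⊛ (xpow (suc i) ⊛ Npartial (suc n) (n ∸ i))
    unfold i (s≤s i≤n) = begin
      xpow (suc i) ⊛ Npartial (suc (suc n)) (suc n ∸ i)
        ≡⟨ ≡.cong (λ k → xpow (suc i) ⊛ Npartial (suc (suc n)) k) (+-∸-assoc 1 i≤n) ⟩
      xpow (suc i) ⊛ Npartial (suc (suc n)) (suc (n ∸ i))
        ≈⟨ ⊛-congˡ (xpow (suc i)) (Npartial-suc (suc n) (n ∸ i) (≤-trans (m∸n≤m n i) (≤-trans (n≤1+n n) (n≤1+n (suc n))))) ⟩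
      xpow (suc i) ⊛ (oneS ⊕ Y ⊛ Npartial (suc n) (n ∸ i))
        ≈⟨ solve 3 (λ X Y S → X :* (con 1ℤ :+ Y :* S) := X :+ Y :* (X :* S)) refl (xpow (suc i)) Y (Npartial (suc n) (n ∸ i)) ⟩
      xpow (suc i) ⊕ Y ⊛ (xpow (suc i) ⊛ Npartial (suc n) (n ∸ i)) ∎

  N-B-identity : ∀ n →
    Nterm (suc n) (suc n) ⊕ (oneS ⊖ xS ⊛ u) ⊛ N (suc n) ⊕ u ⊛ (oneS ⊖ xS) ⊛ B n ≈S oneS
  N-B-identity zero = begin
    Nterm 1 1 ⊕ (oneS ⊖ xS ⊛ u) ⊛ N 1 ⊕ u ⊛ (oneS ⊖ xS) ⊛ zeroS
      ≈⟨ ⊕-nullʳ _ (zeroʳ (u ⊛ (oneS ⊖ xS))) ⟩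
    Nterm 1 1 ⊕ (oneS ⊖ xS ⊛ u) ⊛ (zeroS ⊕ Nterm 1 0)
      ≈⟨ +-cong (trans (Nterm-shift 1 0 0 1 (Nexp-suc-suc 0 0 z≤n)) (⊛-congˡ (xS ⊛ u) (Nterm-zero 0)))
                (⊛-congˡ (oneS ⊖ xS ⊛ u) (trans (+-identityˡ (Nterm 1 0)) (Nterm-zero 1))) ⟩
    xS ⊛ u ⊛ oneS ⊕ (oneS ⊖ xS ⊛ u) ⊛ oneS
      ≈⟨ solve 2 (λ x u → x :* u :* con 1ℤ :+ (con 1ℤ :- x :* u) :* con 1ℤ := con 1ℤ) refl xS u ⟩
    oneS ∎
  N-B-identity (suc n) = begin
    Nterm (suc m) (suc m) ⊕ (oneS ⊖ xS ⊛ u) ⊛ N (suc m) ⊕ u ⊛ (oneS ⊖ xS) ⊛ B (suc n)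
      ≈⟨ +-cong (+-cong (Nterm-shift (suc m) m m (suc m) (Nexp-suc-suc m m ≤-refl))
                        (⊛-congˡ (oneS ⊖ xS ⊛ u) (Npartial-suc m m (n≤1+n m))))
                (⊛-congˡ (u ⊛ (oneS ⊖ xS)) (B-suc n)) ⟩
    X ⊛ u ⊛ Nterm m m ⊕ (oneS ⊖ xS ⊛ u) ⊛ (oneS ⊕ X ⊛ u ⊛ N m) ⊕ u ⊛ (oneS ⊖ xS) ⊛ (A m ⊕ X ⊛ u ⊛ B n)
      ≈⟨ solve 8 (λ X y g τ x N A B →
           X :* (y :* g) :* τ :+ (con 1ℤ :- x :* (y :* g)) :* (con 1ℤ :+ X :* (y :* g) :* N)
             :+ (y :* g) :* (con 1ℤ :- x) :* (A :+ X :* (y :* g) :* B)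
           := con 1ℤ :+ (X :* (y :* g) :* ((τ :+ (con 1ℤ :- x :* (y :* g)) :* N :+ (y :* g) :* (con 1ℤ :- x) :* B) :- con 1ℤ)
                        :+ (y :* g) :* ((con 1ℤ :- x) :* A :- (x :- X))))
           refl X yS geomX (Nterm m m) xS (N m) (A m) (B n) ⟩
    oneS ⊕ (X ⊛ u ⊛ ((Nterm m m ⊕ (oneS ⊖ xS ⊛ u) ⊛ N m ⊕ u ⊛ (oneS ⊖ xS) ⊛ B n) ⊖ oneS)
            ⊕ u ⊛ ((oneS ⊖ xS) ⊛ A m ⊖ (xS ⊖ X)))
      ≈⟨ ⊕-nullʳ oneS (⊕-null (⊛-null (X ⊛ u) (⊖-null (N-B-identity n))) (⊛-null u (⊖-null ([1-x]⊛A m)))) ⟩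
    oneS ∎
    where
    m = suc n
    X = xpow (suc m)

  W-as-A-B : ∀ n → W n ≈S qS ⊛ A n ⊕ (oneS ⊖ qS) ⊛ B n
  W-as-A-B n = begin
    ΣS n (λ i → xpow (suc i) ⊛ P n (n ∸ suc i))
      ≈⟨ ΣS-cong-< n split ⟩
    ΣS n (λ i → qS ⊛ xpow (suc i) ⊕ (oneS ⊖ qS) ⊛ (xpow (suc i) ⊛ Npartial (suc n) (n ∸ i)))
      ≈⟨ ΣS-distrib-⊕ n _ _ ⟩
    ΣS n (λ i → qS ⊛ xpow (suc i)) ⊕ ΣS n (λ i → (oneS ⊖ qS) ⊛ (xpow (suc i) ⊛ Npartial (suc n) (n ∸ i)))
      ≈⟨ +-cong (⊛-distribˡ-ΣS n qS (λ i → xpow (suc i)))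
                (⊛-distribˡ-ΣS n (oneS ⊖ qS) (λ i → xpow (suc i) ⊛ Npartial (suc n) (n ∸ i))) ⟨
    qS ⊛ A n ⊕ (oneS ⊖ qS) ⊛ B n ∎
    where
    split : ∀ i → i < n →
      xpow (suc i) ⊛ P n (n ∸ suc i) ≈S qS ⊛ xpow (suc i) ⊕ (oneS ⊖ qS) ⊛ (xpow (suc i) ⊛ Npartial (suc n) (n ∸ i))
    split i i<n = begin
      xpow (suc i) ⊛ (qS ⊕ (oneS ⊖ qS) ⊛ Npartial (suc n) (suc (n ∸ suc i)))
        ≡⟨ ≡.cong (λ k → xpow (suc i) ⊛ (qS ⊕ (oneS ⊖ qS) ⊛ Npartial (suc n) k)) (+-∸-assoc 1 i<n) ⟨
      xpow (suc i) ⊛ (qS ⊕ (oneS ⊖ qS) ⊛ Npartial (suc n) (n ∸ i))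
        ≈⟨ solve 3 (λ X q S → X :* (q :+ (con 1ℤ :- q) :* S) := q :* X :+ (con 1ℤ :- q) :* (X :* S))
             refl (xpow (suc i)) qS (Npartial (suc n) (n ∸ i)) ⟩
      qS ⊛ xpow (suc i) ⊕ (oneS ⊖ qS) ⊛ (xpow (suc i) ⊛ Npartial (suc n) (n ∸ i)) ∎

  Den-as-Q : ∀ n → Den (suc n) ≈S Q n
  Den-as-Q n = begin
    Den (suc n)
      ≈⟨ +-cong top-term (⊛-congˡ ((oneS ⊖ xS ⊖ xS ⊛ yS) ⊛ geomX) (Num-as-P n)) ⟩
    (oneS ⊖ qS) ⊛ Nterm m m ⊕ (oneS ⊖ xS ⊖ xS ⊛ yS) ⊛ geomX ⊛ P n n
      ≈⟨ solve 9 (λ q x y g τ N A B X →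
           (con 1ℤ :- q) :* τ :+ (con 1ℤ :- x :- x :* y) :* g :* (q :+ (con 1ℤ :- q) :* N)
           := (con 1ℤ :- y :* (q :* A :+ (con 1ℤ :- q) :* B) :- y :* X :* g :* q)
              :+ ((con 1ℤ :- q) :* ((τ :+ (con 1ℤ :- x :* (y :* g)) :* N :+ y :* g :* (con 1ℤ :- x) :* B) :- con 1ℤ)
                  :+ q :* y :* g :* ((con 1ℤ :- x) :* A :- (x :- X))
                  :+ (:- (q :+ (con 1ℤ :- q) :* N :- (con 1ℤ :- q) :* y :* B :- q :* y :* A))
                     :* (con 1ℤ :- (con 1ℤ :- x) :* g)))
           refl qS xS yS geomX (Nterm m m) (N m) (A n) (B n) (xpow m) ⟩
    Q′ ⊕ ((oneS ⊖ qS) ⊛ ρ₁ ⊕ qS ⊛ yS ⊛ geomX ⊛ ρ₂ ⊕ κ ⊛ (oneS ⊖ (oneS ⊖ xS) ⊛ geomX))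
      ≈⟨ ⊕-nullʳ Q′ (⊕-null (⊕-null (⊛-null (oneS ⊖ qS) (⊖-null (N-B-identity n)))
                                    (⊛-null (qS ⊛ yS ⊛ geomX) (⊖-null ([1-x]⊛A n))))
                            (⊛-null κ geomX-null)) ⟩
    Q′
      ≈⟨ ⊕-congʳ (⊝ (yS ⊛ xpow m ⊛ geomX ⊛ qS)) (⊕-congˡ oneS (-‿cong (⊛-congˡ yS (W-as-A-B n)))) ⟨
    Q n ∎
    where
    m = suc n
    Q′ = oneS ⊖ yS ⊛ (qS ⊛ A n ⊕ (oneS ⊖ qS) ⊛ B n) ⊖ yS ⊛ xpow m ⊛ geomX ⊛ qS
    ρ₁ = (Nterm m m ⊕ (oneS ⊖ xS ⊛ u) ⊛ N m ⊕ u ⊛ (oneS ⊖ xS) ⊛ B n) ⊖ oneS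
    ρ₂ = (oneS ⊖ xS) ⊛ A n ⊖ (xS ⊖ xpow m)
    κ = ⊝ (qS ⊕ (oneS ⊖ qS) ⊛ N m ⊖ (oneS ⊖ qS) ⊛ yS ⊛ B n ⊖ qS ⊛ yS ⊛ A n)
    top-term : (oneS ⊖ qS) ⊛ mono (suc m C 2) 0 0 ⊛ powS u m ≈S (oneS ⊖ qS) ⊛ Nterm m m
    top-term = trans (solve 3 (λ a b c → a :* b :* c := a :* (b :* c)) refl (oneS ⊖ qS) (mono (suc m C 2) 0 0) (powS u m))
                     (⊛-congˡ (oneS ⊖ qS) (Nterm-diagonal m))



open import Defs
open import Data.Nat using (ℕ; suc; _≤_)
open import Relation.Binary.PropositionalEquality using (_≡_)
import Relation.Binary.PropositionalEquality as ≡
open SeriesRing using (serRing; _≈S_; coeffs; coeff)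
open SeriesSolver using (solve; _:=_; _:*_)
open SeriesFacts using (⊛-congˡ; ⊛-congʳ)
open Counting using (F-coefficient)
open StateSeries using (H; H-rec-<; H-rec-top)
open LinearSystem using (P; Q; module Solution)
open ClosedForm using (Num-as-P; Den-as-Q)
open CommutativeRing serRing using (setoid; refl; *-cong; *-identityʳ)
open import Relation.Binary.Reasoning.Setoid setoid

F⊛Den≈Num : ∀ m′ → F (suc m′) ⊛ Den (suc m′) ≈S Num (suc m′)
F⊛Den≈Num m′ = begin
  F (suc m′) ⊛ Den (suc m′)   ≈⟨ ⊛-congʳ (Den (suc m′)) (coeffs (F-coefficient m′)) ⟩
  H m′ 0 ⊛ Den (suc m′)       ≈⟨ *-cong (Hs-as-P m′ 0 ≡.refl) (Den-as-Q m′) ⟩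
  H m′ m′ ⊛ P m′ m′ ⊛ Q m′    ≈⟨ solve 3 (λ E P Q → E :* P :* Q := P :* (E :* Q)) refl (H m′ m′) (P m′ m′) (Q m′) ⟩
  P m′ m′ ⊛ (H m′ m′ ⊛ Q m′)  ≈⟨ ⊛-congˡ (P m′ m′) Hs⊛Q≈1 ⟩
  P m′ m′ ⊛ oneS              ≈⟨ *-identityʳ (P m′ m′) ⟩
  P m′ m′                     ≈⟨ Num-as-P m′ ⟨
  Num (suc m′)                ∎
  where open Solution m′ (H m′) (H-rec-< m′) (H-rec-top m′)

theorem1 : (m : ℕ) → 1 ≤ m →
    ∀ a b c → (F m ⊛ Den m) a b c ≡ Num m a b c
theorem1 (suc m′) _ = coeff (F⊛Den≈Num m′)
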